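{- Let $G$ be a cubic partial cube. (1) If a 4-cycle and an isometric 6-cycle of $G$ share two edges, then some vertex of $G$ lies in three 4-cycles. (2) If two isometric 6-cycles of $G$ share more than one edge, then either $G$ is the hypercube $Q_3$ of dimension 3, or both cycles are contained in an isometric subgraph of $G$ isomorphic to the graph $X$.
   Context: A subgraph $H$ of $G$ is isometric if $d_H(x,y)=d_G(x,y)$ for all $x,y\in V(H)$; a cycle is isometric if it is an isometric subgraph. A partial cube is a graph isomorphic to an isometric subgraph of a hypercube. The graph $X$ has ten vertices $v_1,\dots,v_8,c_1,c_2$, and edges forming the 8-cycle $v_1v_2v_3v_4v_5v_6v_7v_8v_1$ together with the edges $c_1v_8$, $c_1v_4$, $c_2v_2$, $c_2v_6$. -}

module Defs where

open import Data.Nat using (ℕ; zero; suc; _≤_)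
open import Data.Fin using (Fin; toℕ; zero; suc; #_)
open import Data.Vec using (Vec; lookup)
open import Data.Bool using (Bool)
open import Data.Product using (Σ; ∃; ∃-syntax; _×_; _,_)
open import Data.Sum using (_⊎_)
open import Relation.Nullary using (¬_)
open import Relation.Binary.PropositionalEquality using (_≡_; _≢_)
open import Function.Definitions using (Bijective)

record Graph (V : Set) : Set₁ where
  field
    Adj : V → V → Set
open Graph public

Simple : ∀ {V} → Graph V → Set
Simple {V} G = (∀ x y → Adj G x y → Adj G y x) × (∀ x → ¬ Adj G x x)

Cubic : ∀ {V} → Graph V → Set
Cubic {V} G = ∀ v → Σ V λ a → Σ V λ b → Σ V λ c →
  a ≢ b × a ≢ c × b ≢ c ×
  (∀ w → (Adj G v w → (w ≡ a ⊎ w ≡ b ⊎ w ≡ c)) × ((w ≡ a ⊎ w ≡ b ⊎ w ≡ c) → Adj G v w))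

data Walk {V : Set} (G : Graph V) : V → V → ℕ → Set where
  nil  : ∀ {x} → Walk G x x 0
  cons : ∀ {x y z k} → Adj G x y → Walk G y z k → Walk G x z (suc k)

Dist : ∀ {V} → Graph V → V → V → ℕ → Set
Dist G x y k = Walk G x y k × (∀ m → Walk G x y m → k ≤ m)

-- f : H → G is distance preserving, i.e. H is isomorphic (via f) to an
-- isometric subgraph of G (injectivity and edge-preservation follow from
-- preservation of distances 0 and 1).
IsometricEmbedding : ∀ {V W} → Graph V → Graph W → (V → W) → Set
IsometricEmbedding {V} H G f = ∀ (x y : V) (k : ℕ) →
  (Dist H x y k → Dist G (f x) (f y) k) × (Dist G (f x) (f y) k → Dist H x y k)

Hypercube : (d : ℕ) → Graph (Vec Bool d)
Hypercube d = record { Adj = λ u v → Σ (Fin d) λ i →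
  lookup u i ≢ lookup v i × (∀ j → j ≢ i → lookup u j ≡ lookup v j) }

PartialCube : ∀ {V} → Graph V → Set
PartialCube {V} G = Σ ℕ λ d → Σ (V → Vec Bool d) λ f → IsometricEmbedding G (Hypercube d) f

Isomorphic : ∀ {V W} → Graph V → Graph W → Set
Isomorphic {V} {W} G H = Σ (V → W) λ f → Bijective _≡_ _≡_ f ×
  (∀ x y → (Adj G x y → Adj H (f x) (f y)) × (Adj H (f x) (f y) → Adj G x y))

Step : (k : ℕ) → Fin k → Fin k → Set
Step k i j = (suc (toℕ i) ≡ toℕ j) ⊎ (suc (toℕ i) ≡ k × toℕ j ≡ 0)

CycleGraph : (k : ℕ) → Graph (Fin k)
CycleGraph k = record { Adj = λ i j → Step k i j ⊎ Step k j i }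

record Cycle {V : Set} (G : Graph V) (k : ℕ) : Set where
  field
    vtx : Fin k → V
    inj : ∀ i j → vtx i ≡ vtx j → i ≡ j
    edge : ∀ i j → Step k i j → Adj G (vtx i) (vtx j)
open Cycle public

IsometricCycle : ∀ {V} {G : Graph V} {k} → Cycle G k → Set
IsometricCycle {G = G} {k} C = IsometricEmbedding (CycleGraph k) G (vtx C)

EdgeOf : ∀ {V} {G : Graph V} {k} → Cycle G k → V → V → Set
EdgeOf {k = k} C x y = Σ (Fin k) λ i → Σ (Fin k) λ j → Step k i j ×
  ((vtx C i ≡ x × vtx C j ≡ y) ⊎ (vtx C i ≡ y × vtx C j ≡ x))

OnCycle : ∀ {V} {G : Graph V} {k} → V → Cycle G k → Set
OnCycle {k = k} v C = Σ (Fin k) λ i → vtx C i ≡ v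

SameCycle : ∀ {V} {G : Graph V} {k l} → Cycle G k → Cycle G l → Set
SameCycle {V} C D = ∀ (x y : V) → (EdgeOf C x y → EdgeOf D x y) × (EdgeOf D x y → EdgeOf C x y)

ShareTwoEdges : ∀ {V} {G : Graph V} {k l} → Cycle G k → Cycle G l → Set
ShareTwoEdges {V} C D = Σ V λ x → Σ V λ y → Σ V λ x' → Σ V λ y' →
  EdgeOf C x y × EdgeOf D x y × EdgeOf C x' y' × EdgeOf D x' y' ×
  ¬ ((x ≡ x' × y ≡ y') ⊎ (x ≡ y' × y ≡ x'))

-- The graph X: v1..v8 = 0..7, c1 = 8, c2 = 9.
data XEdge : Fin 10 → Fin 10 → Set where
  e12 : XEdge (# 0) (# 1)
  e23 : XEdge (# 1) (# 2)
  e34 : XEdge (# 2) (# 3)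
  e45 : XEdge (# 3) (# 4)
  e56 : XEdge (# 4) (# 5)
  e67 : XEdge (# 5) (# 6)
  e78 : XEdge (# 6) (# 7)
  e81 : XEdge (# 7) (# 0)
  c1v8 : XEdge (# 8) (# 7)
  c1v4 : XEdge (# 8) (# 3)
  c2v2 : XEdge (# 9) (# 1)
  c2v6 : XEdge (# 9) (# 5)

XGraph : Graph (Fin 10)
XGraph = record { Adj = λ a b → XEdge a b ⊎ XEdge b a }

ContainedIn : ∀ {V} {G : Graph V} {k} → Cycle G k → (Fin 10 → V) → Set
ContainedIn {k = k} C f = ∀ i j → Step k i j → Σ (Fin 10) λ a → Σ (Fin 10) λ b →
  Adj XGraph a b × f a ≡ vtx C i × f b ≡ vtx C j

-- G is embedded isometrically in the
-- hypercube Q_d by f, and the whole argument is carried out in coordinates: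
-- a frame (p, F) is the subcube through p spanned by distinct directions F,
-- and a vertex x has code s in it when f x = pos p F s.  Within a frame,
-- distance and adjacency of vertices are those of their codes.
--
-- The key structural lemma (IsometricHexagons) says that an isometric 6-cycle
-- carries the codes 000, 001, 011, 111, 110, 100 in a 3-dimensional frame
-- centred at either end of any of its edges.
module Submission where

open import Defs
open import Data.Nat using (ℕ; zero; suc; _+_; _≤_; z≤n; s≤s)
import Data.Nat as ℕ
open import Data.Nat.GeneralisedArithmetic using (iterate)
open import Data.Nat.Properties using (≤-refl; ≤-trans; ≤-reflexive; ≤-antisym; +-suc; +-mono-≤; suc-injective; 0≢1+n; n<1+n)
open import Data.Fin using (Fin; zero; suc; toℕ; _<_)
open import Data.Fin.Patterns using (0F; 1F; 2F; 3F; 4F; 5F; 6F; 7F; 8F; 9F)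
open import Data.Fin.Properties using (_≟_; any?; all?; pigeonhole; <⇒≢)
open import Data.Vec using (Vec; []; _∷_; lookup)
open import Data.Vec.Properties using (tabulate∘lookup; tabulate-cong) renaming (≡-dec to ≡-decᵛ)
open import Data.Vec.Relation.Unary.All using (All; []; _∷_)
open import Data.Vec.Relation.Unary.All.Properties using (lookup⁺)
open import Data.Vec.Relation.Unary.Any using (here; there; index)
open import Data.Vec.Relation.Unary.Unique.Propositional using (Unique; []; _∷_)
open import Data.Vec.Relation.Unary.Unique.Propositional.Properties using (lookup-injective)
open import Data.Vec.Membership.Propositional using (_∈_)
open import Data.Bool using (Bool; true; false; not; T)
open import Data.Bool.Properties using (not-¬; ¬-not; T?) renaming (_≟_ to _≟ᵇ_)
open import Data.Maybe using (Maybe; just; nothing; is-just; to-witness-T; _<∣>_)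
import Data.Maybe
open import Data.Product using (Σ; _×_; _,_; proj₁; proj₂)
open import Data.Sum using (_⊎_; inj₁; inj₂)
open import Data.Empty using (⊥; ⊥-elim)
open import Function using (_∘_; id; case_of_)
open import Relation.Nullary using (¬_; Dec; yes; no; contradiction)
open import Relation.Nullary.Decidable using (_⊎-dec_; _×-dec_; _→-dec_; ¬?; toWitness; dec⇒maybe)
open import Relation.Binary.PropositionalEquality
open import Algebra.Properties.CommutativeSemigroup Data.Nat.Properties.+-commutativeSemigroup using (interchange)

module Hamming where

  δ : Bool → Bool → ℕ
  δ false false = 0
  δ false true  = 1
  δ true  false = 1
  δ true  true  = 0

  ham : ∀ {d} → Vec Bool d → Vec Bool d → ℕ
  ham []       []       = 0
  ham (x ∷ xs) (y ∷ ys) = δ x y + ham xs ys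

  flip : ∀ {d} → Fin d → Vec Bool d → Vec Bool d
  flip zero    (x ∷ xs) = not x ∷ xs
  flip (suc i) (x ∷ xs) = x ∷ flip i xs

  flipIf : ∀ {d} → Bool → Fin d → Vec Bool d → Vec Bool d
  flipIf false i u = u
  flipIf true  i u = flip i u

  ham-refl : ∀ {d} (u : Vec Bool d) → ham u u ≡ 0
  ham-refl []           = refl
  ham-refl (false ∷ u)  = ham-refl u
  ham-refl (true ∷ u)   = ham-refl u

  ham-sym : ∀ {d} (u v : Vec Bool d) → ham u v ≡ ham v u
  ham-sym []          []          = refl
  ham-sym (false ∷ u) (false ∷ v) = ham-sym u v
  ham-sym (false ∷ u) (true ∷ v)  = cong suc (ham-sym u v)
  ham-sym (true ∷ u)  (false ∷ v) = cong suc (ham-sym u v)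
  ham-sym (true ∷ u)  (true ∷ v)  = ham-sym u v

  ham≡0⇒≡ : ∀ {d} (u v : Vec Bool d) → ham u v ≡ 0 → u ≡ v
  ham≡0⇒≡ []          []          e = refl
  ham≡0⇒≡ (false ∷ u) (false ∷ v) e = cong (false ∷_) (ham≡0⇒≡ u v e)
  ham≡0⇒≡ (true ∷ u)  (true ∷ v)  e = cong (true ∷_) (ham≡0⇒≡ u v e)

  δ-triangle : ∀ x y z → δ x z ≤ δ x y + δ y z
  δ-triangle false false z     = ≤-refl
  δ-triangle true  true  z     = ≤-refl
  δ-triangle false true  false = z≤n
  δ-triangle false true  true  = s≤s z≤n
  δ-triangle true  false false = s≤s z≤n
  δ-triangle true  false true  = z≤n

  ham-triangle : ∀ {d} (u v w : Vec Bool d) → ham u w ≤ ham u v + ham v w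
  ham-triangle []       []       []       = z≤n
  ham-triangle (x ∷ u) (y ∷ v) (z ∷ w) = begin
    δ x z + ham u w                   ≤⟨ +-mono-≤ (δ-triangle x y z) (ham-triangle u v w) ⟩
    (δ x y + δ y z) + (ham u v + ham v w) ≡⟨ interchange (δ x y) (δ y z) (ham u v) (ham v w) ⟩
    (δ x y + ham u v) + (δ y z + ham v w) ∎
    where open Data.Nat.Properties.≤-Reasoning

  lookup-flip : ∀ {d} (i : Fin d) u → lookup (flip i u) i ≡ not (lookup u i)
  lookup-flip zero    (x ∷ u) = refl
  lookup-flip (suc i) (x ∷ u) = lookup-flip i u

  lookup-flip-≢ : ∀ {d} (i j : Fin d) u → j ≢ i → lookup (flip i u) j ≡ lookup u j
  lookup-flip-≢ zero    zero    (x ∷ u) j≢i = ⊥-elim (j≢i refl)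
  lookup-flip-≢ zero    (suc j) (x ∷ u) j≢i = refl
  lookup-flip-≢ (suc i) zero    (x ∷ u) j≢i = refl
  lookup-flip-≢ (suc i) (suc j) (x ∷ u) j≢i = lookup-flip-≢ i j u (j≢i ∘ cong suc)

  flip-involutive : ∀ {d} (i : Fin d) u → flip i (flip i u) ≡ u
  flip-involutive zero    (false ∷ u) = refl
  flip-involutive zero    (true ∷ u)  = refl
  flip-involutive (suc i) (x ∷ u)     = cong (x ∷_) (flip-involutive i u)

  flip-comm : ∀ {d} (i j : Fin d) u → flip i (flip j u) ≡ flip j (flip i u)
  flip-comm zero    zero    (x ∷ u) = refl
  flip-comm zero    (suc j) (x ∷ u) = refl
  flip-comm (suc i) zero    (x ∷ u) = refl
  flip-comm (suc i) (suc j) (x ∷ u) = cong (x ∷_) (flip-comm i j u)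

  flipIf-comm : ∀ {d} x (i : Fin d) y j u → flipIf x i (flipIf y j u) ≡ flipIf y j (flipIf x i u)
  flipIf-comm false i y     j u = refl
  flipIf-comm true  i false j u = refl
  flipIf-comm true  i true  j u = flip-comm i j u

  flip-injectiveˡ : ∀ {d} (i j : Fin d) u → flip i u ≡ flip j u → i ≡ j
  flip-injectiveˡ i j u e with i ≟ j
  ... | yes i≡j = i≡j
  ... | no  i≢j = ⊥-elim (not-¬ refl (begin
    lookup u i          ≡⟨ lookup-flip-≢ j i u i≢j ⟨
    lookup (flip j u) i ≡⟨ cong (λ w → lookup w i) e ⟨
    lookup (flip i u) i ≡⟨ lookup-flip i u ⟩
    not (lookup u i)    ∎))
    where open ≡-Reasoning

  ham-flip-both : ∀ {d} (i : Fin d) u v → ham (flip i u) (flip i v) ≡ ham u v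
  ham-flip-both zero    (false ∷ u) (false ∷ v) = refl
  ham-flip-both zero    (false ∷ u) (true ∷ v)  = refl
  ham-flip-both zero    (true ∷ u)  (false ∷ v) = refl
  ham-flip-both zero    (true ∷ u)  (true ∷ v)  = refl
  ham-flip-both (suc i) (x ∷ u)     (y ∷ v)     = cong (δ x y +_) (ham-flip-both i u v)

  ham-flip-agree : ∀ {d} (i : Fin d) u v → lookup u i ≡ lookup v i → ham (flip i u) v ≡ suc (ham u v)
  ham-flip-agree zero    (false ∷ u) (false ∷ v) e = refl
  ham-flip-agree zero    (true ∷ u)  (true ∷ v)  e = refl
  ham-flip-agree (suc i) (x ∷ u)     (y ∷ v)     e =
    trans (cong (δ x y +_) (ham-flip-agree i u v e)) (+-suc (δ x y) (ham u v))

  ham-flip-disagree : ∀ {d} (i : Fin d) u v → lookup u i ≢ lookup v i → suc (ham (flip i u) v) ≡ ham u v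
  ham-flip-disagree zero    (false ∷ u) (false ∷ v) ne = ⊥-elim (ne refl)
  ham-flip-disagree zero    (true ∷ u)  (true ∷ v)  ne = ⊥-elim (ne refl)
  ham-flip-disagree zero    (false ∷ u) (true ∷ v)  ne = refl
  ham-flip-disagree zero    (true ∷ u)  (false ∷ v) ne = refl
  ham-flip-disagree (suc i) (x ∷ u)     (y ∷ v)     ne =
    trans (sym (+-suc (δ x y) (ham (flip i u) v))) (cong (δ x y +_) (ham-flip-disagree i u v ne))

  ham-flip-self : ∀ {d} (i : Fin d) u → ham u (flip i u) ≡ 1
  ham-flip-self i u = trans (ham-sym u (flip i u)) (trans (ham-flip-agree i u u refl) (cong suc (ham-refl u)))

  disagreement : ∀ {d} (u v : Vec Bool d) {k} → ham u v ≡ suc k → Σ (Fin d) λ i → lookup u i ≢ lookup v i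
  disagreement []          []          ()
  disagreement (false ∷ u) (true ∷ v)  e = zero , λ ()
  disagreement (true ∷ u)  (false ∷ v) e = zero , λ ()
  disagreement (false ∷ u) (false ∷ v) e = Data.Product.map suc (λ ne → ne) (disagreement u v e)
  disagreement (true ∷ u)  (true ∷ v)  e = Data.Product.map suc (λ ne → ne) (disagreement u v e)

  step-towards : ∀ {d} (u v : Vec Bool d) {k} → ham u v ≡ suc k → Σ (Fin d) λ i → ham (flip i u) v ≡ k
  step-towards u v e with disagreement u v e
  ... | i , ne = i , suc-injective (trans (ham-flip-disagree i u v ne) e)

  ham≡1⇒flip : ∀ {d} (u v : Vec Bool d) → ham u v ≡ 1 → Σ (Fin d) λ i → v ≡ flip i u
  ham≡1⇒flip u v e with step-towards u v e
  ... | i , e' = i , sym (ham≡0⇒≡ (flip i u) v e')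

  hypercube-adj⇒ham≡1 : ∀ {d} (u v : Vec Bool d) → Adj (Hypercube d) u v → ham u v ≡ 1
  hypercube-adj⇒ham≡1 u v (i , ne , same) = trans (cong (ham u) v≡flip) (ham-flip-self i u)
    where
    agree : ∀ j → lookup v j ≡ lookup (flip i u) j
    agree j with j ≟ i
    ... | yes refl = trans (¬-not (ne ∘ sym)) (sym (lookup-flip i u))
    ... | no  j≢i  = trans (sym (same j j≢i)) (sym (lookup-flip-≢ i j u j≢i))
    v≡flip : v ≡ flip i u
    v≡flip = trans (sym (tabulate∘lookup v)) (trans (tabulate-cong agree) (tabulate∘lookup (flip i u)))

  ham≡1⇒hypercube-adj : ∀ {d} (u v : Vec Bool d) → ham u v ≡ 1 → Adj (Hypercube d) u v
  ham≡1⇒hypercube-adj u v e with ham≡1⇒flip u v e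
  ... | i , refl = i , (λ eq → not-¬ refl (trans eq (lookup-flip i u))) , λ j j≢i → sym (lookup-flip-≢ i j u j≢i)

open Hamming

-- If every edge
-- joins codes at Hamming distance 1, the code is injective, and from every
-- vertex some edge decreases the code distance to any given target, then the
-- graph distance equals the code distance.  This describes the hypercube
-- itself, the cycle C₆ and the graph X.
module CodeGraph {V : Set} {r} (H : Graph V) (c : V → Vec Bool r)
  (edge-code : ∀ {x y} → Adj H x y → ham (c x) (c y) ≡ 1)
  (code-injective : ∀ {x y} → c x ≡ c y → x ≡ y)
  (descend : ∀ x y {k} → ham (c x) (c y) ≡ suc k → Σ V λ z → Adj H x z × ham (c z) (c y) ≡ k) where

  walk-length : ∀ {x y k} → Walk H x y k → ham (c x) (c y) ≤ k
  walk-length {x} nil = ≤-reflexive (ham-refl (c x))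
  walk-length {x} {y} (cons {y = z} a w) = ≤-trans (ham-triangle (c x) (c z) (c y))
    (subst (λ q → q + ham (c z) (c y) ≤ _) (sym (edge-code a)) (s≤s (walk-length w)))

  geodesic : ∀ x y k → ham (c x) (c y) ≡ k → Walk H x y k
  geodesic x y zero    e = subst (λ z → Walk H x z 0) (code-injective (ham≡0⇒≡ (c x) (c y) e)) nil
  geodesic x y (suc k) e with descend x y e
  ... | z , a , e' = cons a (geodesic z y k e')

  dist⇒ham : ∀ {x y k} → Dist H x y k → ham (c x) (c y) ≡ k
  dist⇒ham {x} {y} (w , shortest) = ≤-antisym (walk-length w) (shortest _ (geodesic x y _ refl))

  ham⇒dist : ∀ {x y k} → ham (c x) (c y) ≡ k → Dist H x y k
  ham⇒dist {x} {y} {k} e = geodesic x y k e , λ m w → subst (_≤ m) e (walk-length w)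

  code-adjacent : ∀ {x y} → ham (c x) (c y) ≡ 1 → Adj H x y
  code-adjacent {x} {y} e with descend x y e
  ... | z , x~z , e' = subst (Adj H x) (code-injective (ham≡0⇒≡ (c z) (c y) e')) x~z

-- For a finite graph the descent condition of a code graph is a decidable
-- property, checked by exhaustive search once a (partial) adjacency oracle
-- produces the edges.
module DescentSearch {m r} (H : Graph (Fin m)) (c : Fin m → Vec Bool r)
  (adj? : ∀ x y → Maybe (Adj H x y)) where

  Descends : Fin m → Fin m → Set
  Descends x y = x ≡ y ⊎ Σ (Fin m) λ z → T (is-just (adj? x z)) × suc (ham (c z) (c y)) ≡ ham (c x) (c y)

  descends? : ∀ x y → Dec (Descends x y)
  descends? x y = (x ≟ y) ⊎-dec any? λ z → T? (is-just (adj? x z)) ×-dec (suc (ham (c z) (c y)) ℕ.≟ ham (c x) (c y))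

  descend : (∀ x y → Descends x y) → ∀ x y {k} → ham (c x) (c y) ≡ suc k →
    Σ (Fin m) λ z → Adj H x z × ham (c z) (c y) ≡ k
  descend all-descend x y e with all-descend x y
  ... | inj₁ refl = ⊥-elim (0≢1+n (trans (sym (ham-refl (c x))) e))
  ... | inj₂ (z , t , e') = z , to-witness-T (adj? x z) t , suc-injective (trans e' e)

hypercube-descend : ∀ {d} (u v : Vec Bool d) {k} → ham u v ≡ suc k →
  Σ (Vec Bool d) λ w → Adj (Hypercube d) u w × ham w v ≡ k
hypercube-descend u v e with step-towards u v e
... | i , e' = flip i u , ham≡1⇒hypercube-adj u (flip i u) (ham-flip-self i u) , e'

module HypercubeDistance {d} = CodeGraph (Hypercube d) id (λ {u} {v} → hypercube-adj⇒ham≡1 u v) id hypercube-descend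

step? : ∀ k i j → Dec (Step k i j)
step? k i j = (suc (toℕ i) ℕ.≟ toℕ j) ⊎-dec ((suc (toℕ i) ℕ.≟ k) ×-dec (toℕ j ℕ.≟ 0))

cycle-adj? : ∀ k i j → Dec (Adj (CycleGraph k) i j)
cycle-adj? k i j = step? k i j ⊎-dec step? k j i

-- For a base vector p and a vector F of distinct coordinates
-- ("directions"), pos p F s is the vertex of the subcube through p spanned
-- by F whose F-coordinates are toggled according to the local code s.
module Frames where

  pos : ∀ {d m} → Vec Bool d → Vec (Fin d) m → Vec Bool m → Vec Bool d
  pos p []      []      = p
  pos p (a ∷ F) (x ∷ s) = flipIf x a (pos p F s)

  lookup-pos : ∀ {d m} (p : Vec Bool d) (F : Vec (Fin d) m) s j → All (j ≢_) F → lookup (pos p F s) j ≡ lookup p j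
  lookup-pos p []      []          j []         = refl
  lookup-pos p (a ∷ F) (false ∷ s) j (_ ∷ j∉F)   = lookup-pos p F s j j∉F
  lookup-pos p (a ∷ F) (true ∷ s)  j (j≢a ∷ j∉F) = trans (lookup-flip-≢ a j (pos p F s) j≢a) (lookup-pos p F s j j∉F)

  ham-flipIf : ∀ {d} (a : Fin d) x y U V → lookup U a ≡ lookup V a → ham (flipIf x a U) (flipIf y a V) ≡ δ x y + ham U V
  ham-flipIf a false false U V e = refl
  ham-flipIf a true  true  U V e = ham-flip-both a U V
  ham-flipIf a true  false U V e = ham-flip-agree a U V e
  ham-flipIf a false true  U V e = trans (ham-sym U (flip a V)) (trans (ham-flip-agree a V U (sym e)) (cong suc (ham-sym V U)))

  ham-pos : ∀ {d m} (p : Vec Bool d) (F : Vec (Fin d) m) → Unique F → ∀ s t → ham (pos p F s) (pos p F t) ≡ ham s t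
  ham-pos p []      []           []      []      = ham-refl p
  ham-pos p (a ∷ F) (a∉F ∷ uF) (x ∷ s) (y ∷ t) =
    trans (ham-flipIf a x y (pos p F s) (pos p F t) (trans (lookup-pos p F s a a∉F) (sym (lookup-pos p F t a a∉F))))
          (cong (δ x y +_) (ham-pos p F uF s t))

  pos-injective : ∀ {d m} (p : Vec Bool d) (F : Vec (Fin d) m) → Unique F → ∀ s t → pos p F s ≡ pos p F t → s ≡ t
  pos-injective p F uF s t e =
    ham≡0⇒≡ s t (trans (sym (ham-pos p F uF s t)) (trans (cong (λ z → ham z (pos p F t)) e) (ham-refl (pos p F t))))

  flip-flipIf : ∀ {d} (i a : Fin d) x u → flip i (flipIf x a u) ≡ flipIf x a (flip i u)
  flip-flipIf i a false u = refl
  flip-flipIf i a true  u = flip-comm i a u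

  flip-pos : ∀ {d m} (p : Vec Bool d) {x} (F : Vec (Fin d) m) s (x∈F : x ∈ F) → flip x (pos p F s) ≡ pos p F (flip (index x∈F) s)
  flip-pos p (a ∷ F) (false ∷ s) (here refl) = refl
  flip-pos p (a ∷ F) (true ∷ s)  (here refl) = flip-involutive a (pos p F s)
  flip-pos p (a ∷ F) (x ∷ s)     (there x∈F) = trans (flip-flipIf _ a x (pos p F s)) (cong (flipIf x a) (flip-pos p F s x∈F))

  membership : ∀ {d m} (x : Fin d) (F : Vec (Fin d) m) → x ∈ F ⊎ All (x ≢_) F
  membership x []      = inj₂ []
  membership x (a ∷ F) with x ≟ a | membership x F
  ... | yes x≡a | _          = inj₁ (here x≡a)
  ... | no  _   | inj₁ x∈F   = inj₁ (there x∈F)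
  ... | no  x≢a | inj₂ x∉F   = inj₂ (x≢a ∷ x∉F)

  swap-first : ∀ {d m} (p : Vec Bool d) (a₁ a₂ : Fin d) (F : Vec (Fin d) m) b₁ b₂ s →
    pos p (a₁ ∷ a₂ ∷ F) (b₁ ∷ b₂ ∷ s) ≡ pos p (a₂ ∷ a₁ ∷ F) (b₂ ∷ b₁ ∷ s)
  swap-first p a₁ a₂ F b₁ b₂ s = flipIf-comm b₁ a₁ b₂ a₂ (pos p F s)

  FrameStep : ∀ {d m} → Vec Bool d → Vec (Fin d) m → Vec Bool m → Vec Bool d → Set
  FrameStep {d} {m} p F s v = (Σ (Fin m) λ k → v ≡ pos p F (flip k s)) ⊎ (Σ (Fin d) λ x → All (x ≢_) F × v ≡ pos p (x ∷ F) (true ∷ s))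

  flip-frame : ∀ {d m} (p : Vec Bool d) (F : Vec (Fin d) m) s x → FrameStep p F s (flip x (pos p F s))
  flip-frame p F s x with membership x F
  ... | inj₁ x∈F = inj₁ (index x∈F , flip-pos p F s x∈F)
  ... | inj₂ x∉F = inj₂ (x , x∉F , refl)

open Frames

module PartialCube {n d} (G : Graph (Fin n)) (simple : Simple G) (f : Fin n → Vec Bool d)
  (iso : IsometricEmbedding G (Hypercube d) f) where

  dist⇒ham : ∀ {x y k} → Dist G x y k → ham (f x) (f y) ≡ k
  dist⇒ham {x} {y} {k} D = HypercubeDistance.dist⇒ham (proj₁ (iso x y k) D)

  ham⇒dist : ∀ {x y k} → ham (f x) (f y) ≡ k → Dist G x y k
  ham⇒dist {x} {y} {k} e = proj₂ (iso x y k) (HypercubeDistance.ham⇒dist e)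

  f-injective : ∀ {x y} → f x ≡ f y → x ≡ y
  f-injective {x} {y} e with ham⇒dist {x} {y} {0} (trans (cong (ham (f x)) (sym e)) (ham-refl (f x)))
  ... | nil , _ = refl

  -- ... and edges are exactly the pairs at Hamming distance 1 (since G has
  -- no loops, an edge is a shortest walk).
  adj⇒ham≡1 : ∀ {x y} → Adj G x y → ham (f x) (f y) ≡ 1
  adj⇒ham≡1 {x} {y} a = dist⇒ham (cons a nil , shortest)
    where
    shortest : ∀ m → Walk G x y m → 1 ≤ m
    shortest zero    nil = ⊥-elim (proj₂ simple x a)
    shortest (suc m) w   = s≤s z≤n

  ham≡1⇒adj : ∀ {x y} → ham (f x) (f y) ≡ 1 → Adj G x y
  ham≡1⇒adj e with ham⇒dist e
  ... | cons a nil , _ = a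

  module InFrame (p : Vec Bool d) {m} (F : Vec (Fin d) m) (uF : Unique F) where

    _↦_ : Fin n → Vec Bool m → Set
    x ↦ s = f x ≡ pos p F s

    code-ham : ∀ {x y s t} → x ↦ s → y ↦ t → ham (f x) (f y) ≡ ham s t
    code-ham {s = s} {t} x↦s y↦t = trans (cong₂ ham x↦s y↦t) (ham-pos p F uF s t)

    same-code : ∀ {x y s} → x ↦ s → y ↦ s → x ≡ y
    same-code x↦s y↦s = f-injective (trans x↦s (sym y↦s))

    code-unique : ∀ {x s t} → x ↦ s → x ↦ t → s ≡ t
    code-unique {s = s} {t} x↦s x↦t = pos-injective p F uF s t (trans (sym x↦s) x↦t)

    code-distinct : ∀ {x y s t} → x ↦ s → y ↦ t → s ≢ t → x ≢ y
    code-distinct {s = s} {t} x↦s y↦t s≢t refl = s≢t (code-unique {s = s} {t = t} x↦s y↦t)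

    adj⇒code-ham : ∀ {x y s t} → x ↦ s → y ↦ t → Adj G x y → ham s t ≡ 1
    adj⇒code-ham x↦s y↦t a = trans (sym (code-ham x↦s y↦t)) (adj⇒ham≡1 a)

    code-ham⇒adj : ∀ {x y s t} → x ↦ s → y ↦ t → ham s t ≡ 1 → Adj G x y
    code-ham⇒adj x↦s y↦t e = ham≡1⇒adj (trans (code-ham x↦s y↦t) e)

    neighbour : ∀ {x y s} → x ↦ s → Adj G x y → FrameStep p F s (f y)
    neighbour {x} {y} {s} x↦s a with ham≡1⇒flip (f x) (f y) (adj⇒ham≡1 a)
    ... | i , fy≡ = subst (FrameStep p F s) (sym (trans fy≡ (cong (flip i) x↦s))) (flip-frame p F s i)

    coded-isometry : ∀ {k} (H : Graph (Fin k)) (c : Fin k → Vec Bool m)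
      (edge-code : ∀ {x y} → Adj H x y → ham (c x) (c y) ≡ 1)
      (code-injective : ∀ {x y} → c x ≡ c y → x ≡ y)
      (descend : ∀ x y {l} → ham (c x) (c y) ≡ suc l → Σ (Fin k) λ z → Adj H x z × ham (c z) (c y) ≡ l)
      (g : Fin k → Fin n) → (∀ x → g x ↦ c x) → IsometricEmbedding H G g
    coded-isometry H c edge-code code-injective descend g g↦c x y l =
      (λ D → ham⇒dist (trans (code-ham (g↦c x) (g↦c y)) (H.dist⇒ham D))) ,
      (λ D → H.ham⇒dist (trans (sym (code-ham (g↦c x) (g↦c y))) (dist⇒ham D)))
      where module H = CodeGraph H c edge-code code-injective descend

_≟ᵛ_ : ∀ {m} (s t : Vec Bool m) → Dec (s ≡ t)
_≟ᵛ_ = ≡-decᵛ _≟ᵇ_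

module Hexagon where

  code6 : Fin 6 → Vec Bool 3
  code6 0F = false ∷ false ∷ false ∷ []
  code6 1F = false ∷ false ∷ true  ∷ []
  code6 2F = false ∷ true  ∷ true  ∷ []
  code6 3F = true  ∷ true  ∷ true  ∷ []
  code6 4F = true  ∷ true  ∷ false ∷ []
  code6 5F = true  ∷ false ∷ false ∷ []

  next6 prev6 : Fin 6 → Fin 6
  next6 0F = 1F
  next6 1F = 2F
  next6 2F = 3F
  next6 3F = 4F
  next6 4F = 5F
  next6 5F = 0F
  prev6 0F = 5F
  prev6 1F = 0F
  prev6 2F = 1F
  prev6 3F = 2F
  prev6 4F = 3F
  prev6 5F = 4F

  step-next : ∀ i j → Step 6 i j → j ≡ next6 i × i ≡ prev6 j
  step-next = toWitness {a? = all? λ i → all? λ j → step? 6 i j →-dec ((j ≟ next6 i) ×-dec (i ≟ prev6 j))} _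

  edge-code6 : ∀ {i j} → Adj (CycleGraph 6) i j → ham (code6 i) (code6 j) ≡ 1
  edge-code6 {i} {j} = toWitness {a? = all? λ i → all? λ j → cycle-adj? 6 i j →-dec (ham (code6 i) (code6 j) ℕ.≟ 1)} _ i j

  code6-injective : ∀ {i j} → code6 i ≡ code6 j → i ≡ j
  code6-injective {i} {j} = toWitness {a? = all? λ i → all? λ j → (code6 i ≟ᵛ code6 j) →-dec (i ≟ j)} _ i j

  open DescentSearch (CycleGraph 6) code6 (λ i j → dec⇒maybe (cycle-adj? 6 i j))

  descend6 : ∀ i j {k} → ham (code6 i) (code6 j) ≡ suc k → Σ (Fin 6) λ l → Adj (CycleGraph 6) i l × ham (code6 l) (code6 j) ≡ k
  descend6 = descend (toWitness {a? = all? λ i → all? λ j → descends? i j} _)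

  module C6 = CodeGraph (CycleGraph 6) code6 edge-code6 code6-injective descend6

  neighbours-of-0 : ∀ t → ham (code6 0F) (code6 t) ≡ 1 → t ≡ 1F ⊎ t ≡ 5F
  neighbours-of-0 = toWitness {a? = all? λ t → (ham (code6 0F) (code6 t) ℕ.≟ 1) →-dec ((t ≟ 1F) ⊎-dec (t ≟ 5F))} _

  -- The dihedral symmetries of the hexagon: symmetry σ k maps 0 to k and
  -- 1 to the successor (σ = true) or predecessor (σ = false) of k.
  turn : Bool → Fin 6 → Fin 6
  turn true  = next6
  turn false = prev6

  symmetry : Bool → Fin 6 → Fin 6 → Fin 6
  symmetry σ k t = iterate (turn σ) k (toℕ t)

  SymmetryIsometric : Bool → Set
  SymmetryIsometric σ = ∀ k t t' → ham (code6 (symmetry σ k t)) (code6 (symmetry σ k t')) ≡ ham (code6 t) (code6 t')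

  symmetry-isometric? : ∀ σ → Dec (SymmetryIsometric σ)
  symmetry-isometric? σ = all? λ k → all? λ t → all? λ t' →
    ham (code6 (symmetry σ k t)) (code6 (symmetry σ k t')) ℕ.≟ ham (code6 t) (code6 t')

  symmetry-isometric : ∀ σ → SymmetryIsometric σ
  symmetry-isometric true  = toWitness {a? = symmetry-isometric? true} _
  symmetry-isometric false = toWitness {a? = symmetry-isometric? false} _

  SymmetryOnto : Bool → Set
  SymmetryOnto σ = ∀ k i → Σ (Fin 6) λ t → symmetry σ k t ≡ i

  symmetry-onto? : ∀ σ → Dec (SymmetryOnto σ)
  symmetry-onto? σ = all? λ k → all? λ i → any? λ t → symmetry σ k t ≟ i

  symmetry-onto : ∀ σ → SymmetryOnto σ
  symmetry-onto true  = toWitness {a? = symmetry-onto? true} _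
  symmetry-onto false = toWitness {a? = symmetry-onto? false} _

module GraphX where

  xcode : Fin 10 → Vec Bool 4
  xcode 0F = true  ∷ false ∷ false ∷ true  ∷ []
  xcode 1F = true  ∷ true  ∷ false ∷ true  ∷ []
  xcode 2F = true  ∷ true  ∷ true  ∷ true  ∷ []
  xcode 3F = false ∷ true  ∷ true  ∷ true  ∷ []
  xcode 4F = false ∷ true  ∷ true  ∷ false ∷ []
  xcode 5F = false ∷ true  ∷ false ∷ false ∷ []
  xcode 6F = false ∷ false ∷ false ∷ false ∷ []
  xcode 7F = false ∷ false ∷ false ∷ true  ∷ []
  xcode 8F = false ∷ false ∷ true  ∷ true  ∷ []
  xcode 9F = true  ∷ true  ∷ false ∷ false ∷ []

  xedge-code : ∀ {a b} → XEdge a b → ham (xcode a) (xcode b) ≡ 1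
  xedge-code e12  = refl
  xedge-code e23  = refl
  xedge-code e34  = refl
  xedge-code e45  = refl
  xedge-code e56  = refl
  xedge-code e67  = refl
  xedge-code e78  = refl
  xedge-code e81  = refl
  xedge-code c1v8 = refl
  xedge-code c1v4 = refl
  xedge-code c2v2 = refl
  xedge-code c2v6 = refl

  edge-codeX : ∀ {a b} → Adj XGraph a b → ham (xcode a) (xcode b) ≡ 1
  edge-codeX         (inj₁ e) = xedge-code e
  edge-codeX {a} {b} (inj₂ e) = trans (ham-sym (xcode a) (xcode b)) (xedge-code e)

  xcode-injective : ∀ {a b} → xcode a ≡ xcode b → a ≡ b
  xcode-injective {a} {b} = toWitness {a? = all? λ a → all? λ b → (xcode a ≟ᵛ xcode b) →-dec (a ≟ b)} _ a b

  xedge? : ∀ a b → Maybe (XEdge a b)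
  xedge? 0F 1F = just e12
  xedge? 1F 2F = just e23
  xedge? 2F 3F = just e34
  xedge? 3F 4F = just e45
  xedge? 4F 5F = just e56
  xedge? 5F 6F = just e67
  xedge? 6F 7F = just e78
  xedge? 7F 0F = just e81
  xedge? 8F 7F = just c1v8
  xedge? 8F 3F = just c1v4
  xedge? 9F 1F = just c2v2
  xedge? 9F 5F = just c2v6
  xedge? _  _  = nothing

  open DescentSearch XGraph xcode (λ a b → Data.Maybe.map inj₁ (xedge? a b) <∣> Data.Maybe.map inj₂ (xedge? b a))

  descendX : ∀ a b {k} → ham (xcode a) (xcode b) ≡ suc k → Σ (Fin 10) λ c → Adj XGraph a c × ham (xcode c) (xcode b) ≡ k
  descendX = descend (toWitness {a? = all? λ a → all? λ b → descends? a b} _)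

  module X = CodeGraph XGraph xcode edge-codeX xcode-injective descendX

module CubicGraph {n} (G : Graph (Fin n)) (cubic : Cubic G) where

  slot : ∀ {a b c w : Fin n} → w ≡ a ⊎ w ≡ b ⊎ w ≡ c → Fin 3
  slot (inj₁ _)        = 0F
  slot (inj₂ (inj₁ _)) = 1F
  slot (inj₂ (inj₂ _)) = 2F

  slot-injective : ∀ {a b c w w' : Fin n} (p : w ≡ a ⊎ w ≡ b ⊎ w ≡ c) (q : w' ≡ a ⊎ w' ≡ b ⊎ w' ≡ c) →
    slot p ≡ slot q → w ≡ w'
  slot-injective (inj₁ refl)        (inj₁ refl)        _ = refl
  slot-injective (inj₂ (inj₁ refl)) (inj₂ (inj₁ refl)) _ = refl
  slot-injective (inj₂ (inj₂ refl)) (inj₂ (inj₂ refl)) _ = refl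
  slot-injective (inj₁ _)        (inj₂ (inj₁ _)) ()
  slot-injective (inj₁ _)        (inj₂ (inj₂ _)) ()
  slot-injective (inj₂ (inj₁ _)) (inj₁ _)        ()
  slot-injective (inj₂ (inj₁ _)) (inj₂ (inj₂ _)) ()
  slot-injective (inj₂ (inj₂ _)) (inj₁ _)        ()
  slot-injective (inj₂ (inj₂ _)) (inj₂ (inj₁ _)) ()

  no-four-neighbours : ∀ {v} (zs : Vec (Fin n) 4) → Unique zs → All (Adj G v) zs → ⊥
  no-four-neighbours {v} zs unique adjacent with cubic v
  ... | a , b , c , _ , _ , _ , nbr = collision (pigeonhole (n<1+n 3) (slot ∘ among))
    where
    among : ∀ i → lookup zs i ≡ a ⊎ lookup zs i ≡ b ⊎ lookup zs i ≡ c
    among i = proj₁ (nbr (lookup zs i)) (lookup⁺ adjacent i)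
    collision : (Σ (Fin 4) λ i → Σ (Fin 4) λ j → i < j × slot (among i) ≡ slot (among j)) → ⊥
    collision (i , j , i<j , same) = <⇒≢ i<j (lookup-injective unique i j (slot-injective (among i) (among j) same))

  neighbours-exhausted : ∀ {v w} (zs : Vec (Fin n) 3) → Unique zs → All (Adj G v) zs → Adj G v w → w ∈ zs
  neighbours-exhausted {v} {w} zs unique adjacent v~w with membership w zs
  ... | inj₁ w∈zs = w∈zs
  ... | inj₂ w∉zs = ⊥-elim (no-four-neighbours (w ∷ zs) (w∉zs ∷ unique) (v~w ∷ adjacent))

module Cycles {n} (G : Graph (Fin n)) where

  edge-adj : Simple G → ∀ {k} (C : Cycle G k) {x y} → EdgeOf C x y → Adj G x y
  edge-adj simple C (i , j , s , inj₁ (refl , refl)) = edge C i j s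
  edge-adj simple C (i , j , s , inj₂ (refl , refl)) = proj₁ simple _ _ (edge C i j s)

  edge-left : ∀ {k} (C : Cycle G k) {x y} → EdgeOf C x y → OnCycle x C
  edge-left C (i , j , s , inj₁ (e , _)) = i , e
  edge-left C (i , j , s , inj₂ (_ , e)) = j , e

  edge-right : ∀ {k} (C : Cycle G k) {x y} → EdgeOf C x y → OnCycle y C
  edge-right C (i , j , s , inj₁ (_ , e)) = j , e
  edge-right C (i , j , s , inj₂ (e , _)) = i , e

  cycle-adj : Simple G → ∀ {k} (C : Cycle G k) {i j} → Adj (CycleGraph k) i j → Adj G (vtx C i) (vtx C j)
  cycle-adj simple C (inj₁ s) = edge C _ _ s
  cycle-adj simple C (inj₂ s) = proj₁ simple _ _ (edge C _ _ s)

  edge-positions : ∀ {k} (C : Cycle G k) {x y} → EdgeOf C x y →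
    Σ (Fin k) λ i → Σ (Fin k) λ j → vtx C i ≡ x × vtx C j ≡ y × Adj (CycleGraph k) i j
  edge-positions C (i , j , s , inj₁ (eᵢ , eⱼ)) = i , j , eᵢ , eⱼ , inj₁ s
  edge-positions C (i , j , s , inj₂ (eᵢ , eⱼ)) = j , i , eⱼ , eᵢ , inj₂ s

  edge-sym : ∀ {k} (C : Cycle G k) {x y} → EdgeOf C x y → EdgeOf C y x
  edge-sym C (i , j , s , inj₁ (a , b)) = i , j , s , inj₂ (a , b)
  edge-sym C (i , j , s , inj₂ (a , b)) = i , j , s , inj₁ (a , b)

  data SharedEdges {k l} (C : Cycle G k) (D : Cycle G l) : Set where
    common-path : ∀ u w v → EdgeOf C u w → EdgeOf C w v → EdgeOf D u w → EdgeOf D w v → u ≢ v → SharedEdges C D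
    disjoint    : ∀ x y x' y' → EdgeOf C x y → EdgeOf D x y → EdgeOf C x' y' → EdgeOf D x' y' →
      x ≢ x' → x ≢ y' → y ≢ x' → y ≢ y' → SharedEdges C D

  shared-edges : ∀ {k l} (C : Cycle G k) (D : Cycle G l) → ShareTwoEdges C D → SharedEdges C D
  shared-edges C D (x , y , x' , y' , c₁ , d₁ , c₂ , d₂ , different) with x ≟ x' | x ≟ y' | y ≟ x' | y ≟ y'
  ... | yes refl | _ | _ | _ =
    common-path y x y' (edge-sym C c₁) c₂ (edge-sym D d₁) d₂ (λ e → different (inj₁ (refl , e)))
  ... | no _ | yes refl | _ | _ =
    common-path y x x' (edge-sym C c₁) (edge-sym C c₂) (edge-sym D d₁) (edge-sym D d₂) (λ e → different (inj₂ (refl , e)))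
  ... | no _ | no _ | yes refl | _ =
    common-path x y y' c₁ c₂ d₁ d₂ (λ e → different (inj₂ (e , refl)))
  ... | no _ | no _ | no _ | yes refl =
    common-path x y x' c₁ (edge-sym C c₂) d₁ (edge-sym D d₂) (λ e → different (inj₁ (e , refl)))
  ... | no x≢x' | no x≢y' | no y≢x' | no y≢y' = disjoint x y x' y' c₁ d₁ c₂ d₂ x≢x' x≢y' y≢x' y≢y'

module IsometricHexagons {n d} (G : Graph (Fin n)) (simple : Simple G) (f : Fin n → Vec Bool d)
  (iso : IsometricEmbedding G (Hypercube d) f) where

  open PartialCube G simple f iso
  open Hexagon
  open Cycles G

  hexagon-ham : ∀ (D : Cycle G 6) → IsometricCycle D → ∀ i j → ham (f (vtx D i)) (f (vtx D j)) ≡ ham (code6 i) (code6 j)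
  hexagon-ham D isoD i j = dist⇒ham (proj₁ (isoD i j _) (C6.ham⇒dist refl))

  -- Walking around the hexagon, each step either adds a new
  -- direction or moves inside the current frame, and all wrong moves put two
  -- vertices at the wrong distance.
  module HexagonFrame (w : Fin 6 → Fin n) (hw : ∀ i j → ham (f (w i)) (f (w j)) ≡ ham (code6 i) (code6 j)) where

    p : Vec Bool d
    p = f (w 0F)

    clash : ∀ {m} {F : Vec (Fin d) m} → Unique F → ∀ i j s t →
      f (w i) ≡ pos p F s → f (w j) ≡ pos p F t → ham s t ≢ ham (code6 i) (code6 j) → ⊥
    clash {F = F} uF i j s t wi wj wrong = wrong (trans (sym (InFrame.code-ham p F uF wi wj)) (hw i j))

    adjacent : ∀ i j → ham (code6 i) (code6 j) ≡ 1 → Adj G (w i) (w j)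
    adjacent i j e = ham≡1⇒adj (trans (hw i j) e)

    first : Σ (Fin d) λ γ → f (w 1F) ≡ flip γ p
    first = ham≡1⇒flip p (f (w 1F)) (hw 0F 1F)

    second : ∀ {γ} → f (w 1F) ≡ flip γ p →
      Σ (Fin d) λ β → All (β ≢_) (γ ∷ []) × f (w 2F) ≡ pos p (β ∷ γ ∷ []) (true ∷ true ∷ [])
    second {γ} w₁ = case InFrame.neighbour p (γ ∷ []) ([] ∷ []) {s = true ∷ []} w₁ (adjacent 1F 2F refl) of λ where
      (inj₁ (0F , w₂))           → ⊥-elim (clash {F = γ ∷ []} ([] ∷ []) 0F 2F (false ∷ []) (false ∷ []) refl w₂ λ ())
      (inj₂ (β , β∉ , w₂))       → β , β∉ , w₂

    third : ∀ {β γ} → Unique (β ∷ γ ∷ []) → f (w 1F) ≡ flip γ p → f (w 2F) ≡ pos p (β ∷ γ ∷ []) (true ∷ true ∷ []) →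
      Σ (Fin d) λ α → All (α ≢_) (β ∷ γ ∷ []) × f (w 3F) ≡ pos p (α ∷ β ∷ γ ∷ []) (true ∷ true ∷ true ∷ [])
    third {β} {γ} uF w₁ w₂ = case InFrame.neighbour p (β ∷ γ ∷ []) uF {s = true ∷ true ∷ []} w₂ (adjacent 2F 3F refl) of λ where
      (inj₁ (0F , w₃))     → ⊥-elim (clash uF 1F 3F (false ∷ true ∷ []) (false ∷ true ∷ []) w₁ w₃ λ ())
      (inj₁ (1F , w₃))     → ⊥-elim (clash uF 0F 3F (false ∷ false ∷ []) (true ∷ false ∷ []) refl w₃ λ ())
      (inj₂ (α , α∉ , w₃)) → α , α∉ , w₃

    module _ {α β γ} (uF : Unique (α ∷ β ∷ γ ∷ [])) (w₁ : f (w 1F) ≡ flip γ p)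
      (w₂ : f (w 2F) ≡ pos p (α ∷ β ∷ γ ∷ []) (false ∷ true ∷ true ∷ []))
      (w₃ : f (w 3F) ≡ pos p (α ∷ β ∷ γ ∷ []) (true ∷ true ∷ true ∷ [])) where

      F : Vec (Fin d) 3
      F = α ∷ β ∷ γ ∷ []

      fourth : f (w 4F) ≡ pos p F (true ∷ true ∷ false ∷ [])
      fourth = case InFrame.neighbour p F uF {s = true ∷ true ∷ true ∷ []} w₃ (adjacent 3F 4F refl) of λ where
        (inj₁ (0F , w₄))     → ⊥-elim (clash uF 2F 4F (false ∷ true ∷ true ∷ []) (false ∷ true ∷ true ∷ []) w₂ w₄ λ ())
        (inj₁ (1F , w₄))     → ⊥-elim (clash uF 1F 4F (false ∷ false ∷ true ∷ []) (true ∷ false ∷ true ∷ []) w₁ w₄ λ ())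
        (inj₁ (2F , w₄))     → w₄
        (inj₂ (x , x∉ , w₄)) → ⊥-elim (clash (x∉ ∷ uF) 0F 4F (false ∷ false ∷ false ∷ false ∷ []) (true ∷ true ∷ true ∷ true ∷ []) refl w₄ λ ())

      fifth : f (w 5F) ≡ pos p F (true ∷ false ∷ false ∷ [])
      fifth = case InFrame.neighbour p F uF {s = true ∷ true ∷ false ∷ []} fourth (adjacent 4F 5F refl) of λ where
        (inj₁ (0F , w₅))     → ⊥-elim (clash uF 2F 5F (false ∷ true ∷ true ∷ []) (false ∷ true ∷ false ∷ []) w₂ w₅ λ ())
        (inj₁ (1F , w₅))     → w₅
        (inj₁ (2F , w₅))     → ⊥-elim (clash uF 3F 5F (true ∷ true ∷ true ∷ []) (true ∷ true ∷ true ∷ []) w₃ w₅ λ ())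
        (inj₂ (x , x∉ , w₅)) → ⊥-elim (clash (x∉ ∷ uF) 0F 5F (false ∷ false ∷ false ∷ false ∷ []) (true ∷ true ∷ true ∷ false ∷ []) refl w₅ λ ())

      placed : ∀ t → f (w t) ≡ pos p F (code6 t)
      placed 0F = refl
      placed 1F = w₁
      placed 2F = w₂
      placed 3F = w₃
      placed 4F = fourth
      placed 5F = fifth

    hexagon-frame : Σ (Fin d) λ α → Σ (Fin d) λ β → Σ (Fin d) λ γ →
      Unique (α ∷ β ∷ γ ∷ []) × (∀ t → f (w t) ≡ pos p (α ∷ β ∷ γ ∷ []) (code6 t))
    hexagon-frame =
      let γ , w₁ = first
          β , β∉ , w₂ = second w₁
          α , α∉ , w₃ = third (β∉ ∷ [] ∷ []) w₁ w₂
          uF = α∉ ∷ β∉ ∷ [] ∷ []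
      in α , β , γ , uF , placed uF w₁ w₂ w₃

  record CodedBy (D : Cycle G 6) {m} (p : Vec Bool d) (F : Vec (Fin d) m) (c : Fin 6 → Vec Bool m) : Set where
    field
      realise : ∀ t → Σ (Fin 6) λ i → f (vtx D i) ≡ pos p F (c t)
      code-of : ∀ i → Σ (Fin 6) λ t → f (vtx D i) ≡ pos p F (c t)

    carrier : ∀ t → Σ (Fin n) λ z → f z ≡ pos p F (c t)
    carrier t = vtx D (proj₁ (realise t)) , proj₂ (realise t)

  recode : ∀ {D m m'} {p} {F : Vec (Fin d) m} {F' : Vec (Fin d) m'} {c} (r : Vec Bool m → Vec Bool m') →
    (∀ s → pos p F s ≡ pos p F' (r s)) → CodedBy D p F c → CodedBy D p F' (r ∘ c)
  recode {c = c} r same coding = record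
    { realise = λ t → proj₁ (realise t) , trans (proj₂ (realise t)) (same (c t))
    ; code-of = λ i → proj₁ (code-of i) , trans (proj₂ (code-of i)) (same (c (proj₁ (code-of i)))) }
    where open CodedBy coding

  record HexFrame (D : Cycle G 6) (w u : Fin n) : Set where
    field
      α β γ  : Fin d
      unique : Unique (α ∷ β ∷ γ ∷ [])
      coding : CodedBy D (f w) (α ∷ β ∷ γ ∷ []) code6
      u-dir  : f u ≡ flip γ (f w)
    open CodedBy coding public

  centred-frame : ∀ (D : Cycle G 6) → IsometricCycle D → ∀ σ k → HexFrame D (vtx D k) (vtx D (turn σ k))
  centred-frame D isoD σ k =
    let α , β , γ , uF , placed = HexagonFrame.hexagon-frame w hw
        realise : ∀ t → Σ (Fin 6) λ i → f (vtx D i) ≡ pos (f (vtx D k)) (α ∷ β ∷ γ ∷ []) (code6 t)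
        realise t = symmetry σ k t , placed t
        code-of : ∀ i → Σ (Fin 6) λ t → f (vtx D i) ≡ pos (f (vtx D k)) (α ∷ β ∷ γ ∷ []) (code6 t)
        code-of i = let t , e = symmetry-onto σ k i in
          t , subst (λ j → f (vtx D j) ≡ pos (f (vtx D k)) (α ∷ β ∷ γ ∷ []) (code6 t)) e (placed t)
    in record { α = α ; β = β ; γ = γ ; unique = uF
              ; coding = record { realise = realise ; code-of = code-of } ; u-dir = placed 1F }
    where
    w : Fin 6 → Fin n
    w t = vtx D (symmetry σ k t)
    hw : ∀ i j → ham (f (w i)) (f (w j)) ≡ ham (code6 i) (code6 j)
    hw i j = trans (hexagon-ham D isoD (symmetry σ k i) (symmetry σ k j)) (symmetry-isometric σ k i j)

  hexframe-at : ∀ (D : Cycle G 6) {u w} → IsometricCycle D → EdgeOf D u w → HexFrame D w u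
  hexframe-at D isoD (i , j , s , inj₁ (refl , refl)) =
    subst (λ x → HexFrame D (vtx D j) (vtx D x)) (sym (proj₂ (step-next i j s))) (centred-frame D isoD false j)
  hexframe-at D isoD (i , j , s , inj₂ (refl , refl)) =
    subst (λ x → HexFrame D (vtx D i) (vtx D x)) (sym (proj₁ (step-next i j s))) (centred-frame D isoD true i)

  other-neighbour : ∀ {D w u v} (H : HexFrame D w u) → OnCycle v D → Adj G w v → u ≢ v → f v ≡ flip (HexFrame.α H) (f w)
  other-neighbour {D} {w} {u} H (i , refl) w~v u≢v = classify (code-of i)
    where
    open HexFrame H
    open InFrame (f w) (α ∷ β ∷ γ ∷ []) unique
    classify : (Σ (Fin 6) λ t → vtx D i ↦ code6 t) → f (vtx D i) ≡ flip α (f w)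
    classify (t , v-code) = case neighbours-of-0 t (adj⇒code-ham {s = code6 0F} {t = code6 t} refl v-code w~v) of λ where
      (inj₁ refl) → ⊥-elim (u≢v (same-code {s = code6 1F} u-dir v-code))
      (inj₂ refl) → v-code

  hexagon-edge : ∀ (D : Cycle G 6) → IsometricCycle D → ∀ {i j} → Adj G (vtx D i) (vtx D j) → EdgeOf D (vtx D i) (vtx D j)
  hexagon-edge D isoD {i} {j} a = from-C6 (C6.code-adjacent (trans (sym (hexagon-ham D isoD i j)) (adj⇒ham≡1 a)))
    where
    from-C6 : Adj (CycleGraph 6) i j → EdgeOf D (vtx D i) (vtx D j)
    from-C6 (inj₁ s) = i , j , s , inj₁ (refl , refl)
    from-C6 (inj₂ s) = j , i , s , inj₂ (refl , refl)

  edges-follow : ∀ (D E : Cycle G 6) → IsometricCycle E → (∀ i → OnCycle (vtx D i) E) → ∀ {x y} → EdgeOf D x y → EdgeOf E x y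
  edges-follow D E isoE D⊆E e = follow (edge-left D e) (edge-right D e) e
    where
    follow : ∀ {x y} → OnCycle x D → OnCycle y D → EdgeOf D x y → EdgeOf E x y
    follow (i , refl) (j , refl) e =
      let i' , eᵢ = D⊆E i
          j' , eⱼ = D⊆E j
      in subst₂ (EdgeOf E) eᵢ eⱼ (hexagon-edge E isoE (subst₂ (Adj G) (sym eᵢ) (sym eⱼ) (edge-adj simple D e)))

  same-coding⇒same-cycle : ∀ (D E : Cycle G 6) {m} {p} {F : Vec (Fin d) m} {c} → IsometricCycle D → IsometricCycle E →
    CodedBy D p F c → CodedBy E p F c → SameCycle D E
  same-coding⇒same-cycle D E isoD isoE cD cE x y = edges-follow D E isoE (included cD cE) , edges-follow E D isoD (included cE cD)
    where
    included : ∀ {A B} → CodedBy A _ _ _ → CodedBy B _ _ _ → ∀ i → OnCycle (vtx A i) B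
    included cA cB i =
      let t , eA = CodedBy.code-of cA i
          j , eB = CodedBy.realise cB t
      in j , f-injective (trans eB (sym eA))

module Square where

  opposite : Fin 4 → Fin 4
  opposite 0F = 2F
  opposite 1F = 3F
  opposite 2F = 0F
  opposite 3F = 1F

  opposite-adjacent : ∀ a b → Adj (CycleGraph 4) a b → Adj (CycleGraph 4) b (opposite a)
  opposite-adjacent = toWitness {a? = all? λ a → all? λ b → cycle-adj? 4 a b →-dec cycle-adj? 4 b (opposite a)} _

  opposite-≢ : ∀ a → opposite a ≢ a
  opposite-≢ = toWitness {a? = all? λ a → ¬? (opposite a ≟ a)} _

  diameter-two : ∀ i j → i ≡ j ⊎ Adj (CycleGraph 4) i j ⊎ Σ (Fin 4) λ k → Adj (CycleGraph 4) i k × Adj (CycleGraph 4) k j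
  diameter-two = toWitness {a? = all? λ i → all? λ j →
    (i ≟ j) ⊎-dec cycle-adj? 4 i j ⊎-dec any? λ k → cycle-adj? 4 i k ×-dec cycle-adj? 4 k j} _

-- The
-- shared edges cannot be disjoint, since all vertices of C are within
-- distance 2 of each other.  So they form a path u – w – v; in the frame of D
-- centred at w, u and v have codes 001 and 100, which forces the fourth
-- vertex z of C to have code 101.  Then z lies on C and on the two 4-cycles
-- z u 011 111 and z v 110 111 whose other vertices are on D.
module SquareAndHexagon {n d} (G : Graph (Fin n)) (simple : Simple G) (f : Fin n → Vec Bool d)
  (iso : IsometricEmbedding G (Hypercube d) f) where

  open PartialCube G simple f iso
  open IsometricHexagons G simple f iso
  open Cycles G
  open Hexagon
  open Square

  ThreeSquaresAtAVertex : Set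
  ThreeSquaresAtAVertex = Σ (Fin n) λ v → Σ (Cycle G 4) λ C₁ → Σ (Cycle G 4) λ C₂ → Σ (Cycle G 4) λ C₃ →
    ¬ SameCycle C₁ C₂ × ¬ SameCycle C₁ C₃ × ¬ SameCycle C₂ C₃ × OnCycle v C₁ × OnCycle v C₂ × OnCycle v C₃

  square-close : ∀ (C : Cycle G 4) {x y} → OnCycle x C → OnCycle y C → ham (f x) (f y) ≤ 2
  square-close C (i , refl) (j , refl) = case diameter-two i j of λ where
    (inj₁ refl)              → ≤-trans (≤-reflexive (ham-refl (f (vtx C i)))) z≤n
    (inj₂ (inj₁ i~j))        → ≤-trans (≤-reflexive (adj⇒ham≡1 (cycle-adj simple C i~j))) (s≤s z≤n)
    (inj₂ (inj₂ (k , i~k , k~j))) → ≤-trans (ham-triangle (f (vtx C i)) (f (vtx C k)) (f (vtx C j)))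
      (≤-reflexive (cong₂ _+_ (adj⇒ham≡1 (cycle-adj simple C i~k)) (adj⇒ham≡1 (cycle-adj simple C k~j))))

  fourth-vertex : ∀ (C : Cycle G 4) {u w v} → EdgeOf C u w → EdgeOf C w v →
    Σ (Fin n) λ z → Adj G u z × Adj G z v × z ≢ w × OnCycle z C
  fourth-vertex C uw wv with edge-positions C (edge-sym C uw) | edge-positions C wv
  ... | a , b , refl , refl , a~b | a' , c , a'≡a , refl , a'~c with inj C a' a a'≡a
  ... | refl = vtx C (opposite a)
             , cycle-adj simple C (opposite-adjacent a b a~b)
             , proj₁ simple _ _ (cycle-adj simple C (opposite-adjacent a c a'~c))
             , (λ e → opposite-≢ a (inj C _ _ e))
             , opposite a , refl

  coded-square : ∀ {m} (p : Vec Bool d) (F : Vec (Fin d) m) (uF : Unique F) (g : Fin 4 → Fin n) (c : Fin 4 → Vec Bool m) →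
    (∀ i → f (g i) ≡ pos p F (c i)) → (∀ {i j} → c i ≡ c j → i ≡ j) → (∀ i j → Step 4 i j → ham (c i) (c j) ≡ 1) → Cycle G 4
  coded-square p F uF g c g↦c c-injective c-step = record
    { vtx  = g
    ; inj  = λ i j e → c-injective (code-unique (g↦c i) (subst (_↦ c j) (sym e) (g↦c j)))
    ; edge = λ i j s → code-ham⇒adj (g↦c i) (g↦c j) (c-step i j s) }
    where open InFrame p F uF

  off-square : ∀ {m} {p : Vec Bool d} {F : Vec (Fin d) m} (uF : Unique F) {g : Fin 4 → Fin n} {c : Fin 4 → Vec Bool m} →
    (∀ i → f (g i) ≡ pos p F (c i)) → ∀ {x s} → (Σ (Fin 4) λ i → g i ≡ x) → f x ≡ pos p F s → (∀ i → c i ≢ s) → ⊥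
  off-square {p = p} {F} uF g↦c (i , refl) x↦s c≢s = c≢s i (InFrame.code-unique p F uF (g↦c i) x↦s)

  u-square v-square : Fin 4 → Vec Bool 3
  u-square 0F = true  ∷ false ∷ true  ∷ []
  u-square 1F = false ∷ false ∷ true  ∷ []
  u-square 2F = false ∷ true  ∷ true  ∷ []
  u-square 3F = true  ∷ true  ∷ true  ∷ []
  v-square 0F = true  ∷ false ∷ true  ∷ []
  v-square 1F = true  ∷ false ∷ false ∷ []
  v-square 2F = true  ∷ true  ∷ false ∷ []
  v-square 3F = true  ∷ true  ∷ true  ∷ []

  SquareCodes : (Fin 4 → Vec Bool 3) → Set
  SquareCodes c = (∀ i j → c i ≡ c j → i ≡ j) × (∀ i j → Step 4 i j → ham (c i) (c j) ≡ 1)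

  square-codes? : ∀ c → Dec (SquareCodes c)
  square-codes? c = (all? λ i → all? λ j → (c i ≟ᵛ c j) →-dec (i ≟ j))
               ×-dec (all? λ i → all? λ j → step? 4 i j →-dec (ham (c i) (c j) ℕ.≟ 1))

  u-square-ok : SquareCodes u-square
  u-square-ok = toWitness {a? = square-codes? u-square} _

  v-square-ok : SquareCodes v-square
  v-square-ok = toWitness {a? = square-codes? v-square} _

  u-square-avoids-w : ∀ i → u-square i ≢ code6 0F
  u-square-avoids-w = toWitness {a? = all? λ i → ¬? (u-square i ≟ᵛ code6 0F)} _

  v-square-avoids-w : ∀ i → v-square i ≢ code6 0F
  v-square-avoids-w = toWitness {a? = all? λ i → ¬? (v-square i ≟ᵛ code6 0F)} _

  v-square-avoids-u : ∀ i → v-square i ≢ code6 1F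
  v-square-avoids-u = toWitness {a? = all? λ i → ¬? (v-square i ≟ᵛ code6 1F)} _

  module CommonPath (C : Cycle G 4) (D : Cycle G 6) (isoD : IsometricCycle D) {u w v}
    (Cuw : EdgeOf C u w) (Cwv : EdgeOf C w v) (Duw : EdgeOf D u w) (Dwv : EdgeOf D w v) (u≢v : u ≢ v) where

    H : HexFrame D w u
    H = hexframe-at D isoD Duw
    open HexFrame H
    open InFrame (f w) (α ∷ β ∷ γ ∷ []) unique

    v-code : v ↦ code6 5F
    v-code = other-neighbour H (edge-right D Dwv) (edge-adj simple D Dwv) u≢v

    z : Fin n
    z = proj₁ (fourth-vertex C Cuw Cwv)

    u~z : Adj G u z
    u~z = proj₁ (proj₂ (fourth-vertex C Cuw Cwv))

    z~v : Adj G z v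
    z~v = proj₁ (proj₂ (proj₂ (fourth-vertex C Cuw Cwv)))

    z≢w : z ≢ w
    z≢w = proj₁ (proj₂ (proj₂ (proj₂ (fourth-vertex C Cuw Cwv))))

    z-on-C : OnCycle z C
    z-on-C = proj₂ (proj₂ (proj₂ (proj₂ (fourth-vertex C Cuw Cwv))))

    -- z is a neighbour of u (001) and of v (100) other than w (000).
    z-code : z ↦ (true ∷ false ∷ true ∷ [])
    z-code = case neighbour {s = code6 1F} u-dir u~z of λ where
      (inj₁ (0F , e))     → e
      (inj₁ (1F , e))     → contradiction (adj⇒code-ham {s = false ∷ true ∷ true ∷ []} {t = code6 5F} e v-code z~v) λ ()
      (inj₁ (2F , e))     → ⊥-elim (z≢w (same-code {s = code6 0F} e refl))
      (inj₂ (x , x∉ , e)) → contradiction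
        (InFrame.adj⇒code-ham (f w) (x ∷ α ∷ β ∷ γ ∷ []) (x∉ ∷ unique) {s = true ∷ code6 1F} {t = false ∷ code6 5F} e v-code z~v) λ ()

    on-D : Fin 6 → Fin n
    on-D t = vtx D (proj₁ (realise t))

    g₂ g₃ : Fin 4 → Fin n
    g₂ 0F = z
    g₂ 1F = u
    g₂ 2F = on-D 2F
    g₂ 3F = on-D 3F
    g₃ 0F = z
    g₃ 1F = v
    g₃ 2F = on-D 4F
    g₃ 3F = on-D 3F

    g₂-codes : ∀ i → g₂ i ↦ u-square i
    g₂-codes 0F = z-code
    g₂-codes 1F = u-dir
    g₂-codes 2F = proj₂ (realise 2F)
    g₂-codes 3F = proj₂ (realise 3F)

    g₃-codes : ∀ i → g₃ i ↦ v-square i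
    g₃-codes 0F = z-code
    g₃-codes 1F = v-code
    g₃-codes 2F = proj₂ (realise 4F)
    g₃-codes 3F = proj₂ (realise 3F)

    C₂ C₃ : Cycle G 4
    C₂ = coded-square (f w) (α ∷ β ∷ γ ∷ []) unique g₂ u-square g₂-codes (proj₁ u-square-ok _ _) (proj₂ u-square-ok)
    C₃ = coded-square (f w) (α ∷ β ∷ γ ∷ []) unique g₃ v-square g₃-codes (proj₁ v-square-ok _ _) (proj₂ v-square-ok)

    three-squares : ThreeSquaresAtAVertex
    three-squares = z , C , C₂ , C₃
      , (λ same → off-square unique g₂-codes (edge-left C₂ (proj₁ (same w u) (edge-sym C Cuw))) refl u-square-avoids-w)
      , (λ same → off-square unique g₃-codes (edge-left C₃ (proj₁ (same w u) (edge-sym C Cuw))) refl v-square-avoids-w)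
      , (λ same → off-square unique g₃-codes (edge-right C₃ (proj₁ (same z u) z-u-on-C₂)) u-dir v-square-avoids-u)
      , z-on-C , (0F , refl) , (0F , refl)
      where
      z-u-on-C₂ : EdgeOf C₂ z u
      z-u-on-C₂ = 0F , 1F , inj₁ refl , inj₁ (refl , refl)

  NearEdge : Fin 6 → Fin 6 → Set
  NearEdge t t' = ham (code6 t) (code6 t') ≡ 1 →
    ham (code6 0F) (code6 t) ≤ 2 → ham (code6 1F) (code6 t) ≤ 2 →
    ham (code6 0F) (code6 t') ≤ 2 → ham (code6 1F) (code6 t') ≤ 2 →
    t ≡ 0F ⊎ t ≡ 1F ⊎ t' ≡ 0F ⊎ t' ≡ 1F

  near-edges : ∀ t t' → NearEdge t t'
  near-edges = toWitness {a? = all? λ t → all? λ t' →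
    (ham (code6 t) (code6 t') ℕ.≟ 1) →-dec
    (ham (code6 0F) (code6 t) ℕ.≤? 2) →-dec (ham (code6 1F) (code6 t) ℕ.≤? 2) →-dec
    (ham (code6 0F) (code6 t') ℕ.≤? 2) →-dec (ham (code6 1F) (code6 t') ℕ.≤? 2) →-dec
    ((t ≟ 0F) ⊎-dec (t ≟ 1F) ⊎-dec (t' ≟ 0F) ⊎-dec (t' ≟ 1F))} _

  no-disjoint-edges : ∀ (C : Cycle G 4) (D : Cycle G 6) → IsometricCycle D → ∀ {x y x' y'} →
    EdgeOf C x y → EdgeOf D x y → EdgeOf C x' y' → EdgeOf D x' y' → x ≢ x' → x ≢ y' → y ≢ x' → y ≢ y' → ⊥
  no-disjoint-edges C D isoD {x} {y} Cxy Dxy Cx'y' Dx'y' x≢x' x≢y' y≢x' y≢y' =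
    located (edge-left D Dx'y') (edge-right D Dx'y') Cx'y' Dx'y' x≢x' x≢y' y≢x' y≢y'
    where
    H : HexFrame D x y
    H = hexframe-at D isoD (edge-sym D Dxy)
    open HexFrame H
    open InFrame (f x) (α ∷ β ∷ γ ∷ []) unique

    close : ∀ {a b} s s' → OnCycle a C → a ↦ s → OnCycle b C → b ↦ s' → ham s s' ≤ 2
    close s s' a∈C a↦s b∈C b↦s' = subst (_≤ 2) (code-ham {s = s} {t = s'} a↦s b↦s') (square-close C a∈C b∈C)

    -- x and y have codes 000 and 001; the codes t, t' of x', y' must avoid both.
    coded : ∀ {x' y'} t t' → x' ↦ code6 t → y' ↦ code6 t' → EdgeOf C x' y' → EdgeOf D x' y' →
      x ≢ x' → x ≢ y' → y ≢ x' → y ≢ y' → ⊥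
    coded t t' x'↦ y'↦ Cx'y' Dx'y' x≢x' x≢y' y≢x' y≢y' = meets (near-edges t t'
        (adj⇒code-ham {s = code6 t} {t = code6 t'} x'↦ y'↦ (edge-adj simple D Dx'y'))
        (close (code6 0F) (code6 t)  (edge-left C Cxy)  refl  (edge-left C Cx'y')  x'↦)
        (close (code6 1F) (code6 t)  (edge-right C Cxy) u-dir (edge-left C Cx'y')  x'↦)
        (close (code6 0F) (code6 t') (edge-left C Cxy)  refl  (edge-right C Cx'y') y'↦)
        (close (code6 1F) (code6 t') (edge-right C Cxy) u-dir (edge-right C Cx'y') y'↦))
      where
      meets : t ≡ 0F ⊎ t ≡ 1F ⊎ t' ≡ 0F ⊎ t' ≡ 1F → ⊥
      meets (inj₁ refl)               = x≢x' (same-code {s = code6 0F} refl x'↦)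
      meets (inj₂ (inj₁ refl))        = y≢x' (same-code {s = code6 1F} u-dir x'↦)
      meets (inj₂ (inj₂ (inj₁ refl))) = x≢y' (same-code {s = code6 0F} refl y'↦)
      meets (inj₂ (inj₂ (inj₂ refl))) = y≢y' (same-code {s = code6 1F} u-dir y'↦)

    located : ∀ {x' y'} → OnCycle x' D → OnCycle y' D → EdgeOf C x' y' → EdgeOf D x' y' →
      x ≢ x' → x ≢ y' → y ≢ x' → y ≢ y' → ⊥
    located (i , refl) (j , refl) =
      coded (proj₁ (code-of i)) (proj₁ (code-of j)) (proj₂ (code-of i)) (proj₂ (code-of j))

  shared-edges⇒three-squares : ∀ (C : Cycle G 4) (D : Cycle G 6) → IsometricCycle D → ShareTwoEdges C D → ThreeSquaresAtAVertex
  shared-edges⇒three-squares C D isoD shared with shared-edges C D shared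
  ... | common-path u w v Cuw Cwv Duw Dwv u≢v = CommonPath.three-squares C D isoD Cuw Cwv Duw Dwv u≢v
  ... | disjoint x y x' y' Cxy Dxy Cx'y' Dx'y' x≢x' x≢y' y≢x' y≢y' =
    ⊥-elim (no-disjoint-edges C D isoD Cxy Dxy Cx'y' Dx'y' x≢x' x≢y' y≢x' y≢y')


-- Recognising Q₃: if a cubic partial cube realises all eight codes of a
-- 3-dimensional frame, these vertices are closed under taking neighbours, and
-- since G is connected they are all of G; so G is the cube Q₃.
module CubeRecognition {n d} (G : Graph (Fin n)) (simple : Simple G) (f : Fin n → Vec Bool d)
  (iso : IsometricEmbedding G (Hypercube d) f) (cubic : Cubic G)
  (p : Vec Bool d) (F : Vec (Fin d) 3) (uF : Unique F) (realised : ∀ s → Σ (Fin n) λ x → f x ≡ pos p F s) where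

  open PartialCube G simple f iso
  open CubicGraph G cubic
  open InFrame p F uF

  vertex : Vec Bool 3 → Fin n
  vertex s = proj₁ (realised s)

  vertex-code : ∀ s → vertex s ↦ s
  vertex-code s = proj₂ (realised s)

  flips-distinct : ∀ s {k k'} → k ≢ k' → vertex (flip k s) ≢ vertex (flip k' s)
  flips-distinct s {k} {k'} k≢k' e = k≢k' (flip-injectiveˡ k k' s
    (code-unique {s = flip k s} (vertex-code (flip k s)) (subst (_↦ flip k' s) (sym e) (vertex-code (flip k' s)))))

  -- The three frame neighbours of a frame vertex are all its neighbours.
  closed : ∀ {y z} s → y ↦ s → Adj G y z → Σ (Vec Bool 3) λ s' → z ↦ s'
  closed {y} {z} s y↦s y~z = which (neighbours-exhausted (nbr 0F ∷ nbr 1F ∷ nbr 2F ∷ []) distinct adjacent y~z)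
    where
    nbr : Fin 3 → Fin n
    nbr k = vertex (flip k s)
    adjacent : All (Adj G y) (nbr 0F ∷ nbr 1F ∷ nbr 2F ∷ [])
    adjacent = a 0F ∷ a 1F ∷ a 2F ∷ []
      where a = λ k → code-ham⇒adj {s = s} {t = flip k s} y↦s (vertex-code (flip k s)) (ham-flip-self k s)
    distinct : Unique (nbr 0F ∷ nbr 1F ∷ nbr 2F ∷ [])
    distinct = (flips-distinct s (λ ()) ∷ flips-distinct s (λ ()) ∷ []) ∷ (flips-distinct s (λ ()) ∷ []) ∷ [] ∷ []
    which : z ∈ (nbr 0F ∷ nbr 1F ∷ nbr 2F ∷ []) → Σ (Vec Bool 3) λ s' → z ↦ s'
    which (here refl)                = flip 0F s , vertex-code (flip 0F s)
    which (there (here refl))        = flip 1F s , vertex-code (flip 1F s)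
    which (there (there (here refl))) = flip 2F s , vertex-code (flip 2F s)

  along : ∀ {y z k} s → y ↦ s → Walk G y z k → Σ (Vec Bool 3) λ s' → z ↦ s'
  along s y↦s nil          = s , y↦s
  along s y↦s (cons y~y' w) = let s' , y'↦s' = closed s y↦s y~y' in along s' y'↦s' w

  -- G is connected, so every vertex is reached from the vertex with code 000.
  code-of : ∀ z → Σ (Vec Bool 3) λ s → z ↦ s
  code-of z = along base (vertex-code base) (proj₁ (ham⇒dist {vertex base} {z} refl))
    where base = false ∷ false ∷ false ∷ []

  code : Fin n → Vec Bool 3
  code z = proj₁ (code-of z)

  code-injective : ∀ {x y} → code x ≡ code y → x ≡ y
  code-injective {x} {y} e = same-code {s = code y} (subst (x ↦_) e (proj₂ (code-of x))) (proj₂ (code-of y))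

  is-cube : Isomorphic G (Hypercube 3)
  is-cube = code , (code-injective , onto) , λ x y →
    (λ x~y → ham≡1⇒hypercube-adj (code x) (code y) (adj⇒code-ham {s = code x} {t = code y} (proj₂ (code-of x)) (proj₂ (code-of y)) x~y)) ,
    (λ a → code-ham⇒adj {s = code x} {t = code y} (proj₂ (code-of x)) (proj₂ (code-of y)) (hypercube-adj⇒ham≡1 (code x) (code y) a))
    where
    onto : ∀ s → Σ (Fin n) λ x → ∀ {z} → z ≡ x → code z ≡ s
    onto s = vertex s , λ { refl → code-unique {s = code (vertex s)} (proj₂ (code-of (vertex s))) (vertex-code s) }

-- If the shared edges form a path u – w – v, the frames of D
-- and E centred at w share the directions of u and v; the third directions
-- differ (otherwise D = E), so together they span a 4-dimensional frame in
-- which D, E and one further vertex form an isometric copy of X.  If the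
-- shared edges x y and x' y' are disjoint, compare the frames centred at x:
-- either E is D with two directions swapped, and then all eight vertices of
-- a 3-cube are present and cubicity forces G = Q₃; or, in a common frame, D
-- and E have only one code in common besides those of x and y, so x' = y',
-- which is absurd.
module TwoHexagons {n d} (G : Graph (Fin n)) (simple : Simple G) (f : Fin n → Vec Bool d)
  (iso : IsometricEmbedding G (Hypercube d) f) (cubic : Cubic G) where

  open PartialCube G simple f iso
  open IsometricHexagons G simple f iso
  open Cycles G
  open Hexagon
  open GraphX
  open CubicGraph G cubic

  first-distinct : ∀ {a b c : Fin d} → Unique (a ∷ b ∷ c ∷ []) → a ≢ b
  first-distinct ((a≢b ∷ _) ∷ _) = a≢b

  second-distinct : ∀ {a b c : Fin d} → Unique (a ∷ b ∷ c ∷ []) → b ≢ c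
  second-distinct (_ ∷ (b≢c ∷ []) ∷ _) = b≢c

  first-third-distinct : ∀ {a b c : Fin d} → Unique (a ∷ b ∷ c ∷ []) → a ≢ c
  first-third-distinct ((_ ∷ a≢c ∷ []) ∷ _) = a≢c

  InX : Cycle G 6 → Cycle G 6 → Set
  InX D E = Σ (Fin 10 → Fin n) λ g → IsometricEmbedding XGraph G g × ContainedIn D g × ContainedIn E g

  contained : ∀ {k} {p : Vec Bool d} {F : Vec (Fin d) 4} (uF : Unique F) (g : Fin 10 → Fin n) →
    (∀ a → f (g a) ≡ pos p F (xcode a)) → (C : Cycle G k) → (∀ i → Σ (Fin 10) λ a → g a ≡ vtx C i) → ContainedIn C g
  contained {p = p} {F} uF g g-code C covered i j s =
    let a , eᵢ = covered i
        b , eⱼ = covered j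
    in a , b , X.code-adjacent (InFrame.adj⇒code-ham p F uF {s = xcode a} {t = xcode b} (g-code a) (g-code b)
                 (subst₂ (Adj G) (sym eᵢ) (sym eⱼ) (edge C i j s))) , eᵢ , eⱼ

  -- A code in a frame (α, e, γ), rewritten in the frame (e, α, β, γ).
  from-αeγ : Vec Bool 3 → Vec Bool 4
  from-αeγ (a ∷ b ∷ c ∷ []) = b ∷ a ∷ false ∷ c ∷ []

  -- Positions in X of the vertices of D (codes 0 s) and of E (codes from-αeγ s).

  D-place E-place : Fin 6 → Fin 10
  D-place 0F = 6F
  D-place 1F = 7F
  D-place 2F = 8F
  D-place 3F = 3F
  D-place 4F = 4F
  D-place 5F = 5F
  E-place 0F = 6F
  E-place 1F = 7F
  E-place 2F = 0F
  E-place 3F = 1F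
  E-place 4F = 9F
  E-place 5F = 5F

  D-place-code : ∀ t → xcode (D-place t) ≡ false ∷ code6 t
  D-place-code = toWitness {a? = all? λ t → xcode (D-place t) ≟ᵛ (false ∷ code6 t)} _

  E-place-code : ∀ t → xcode (E-place t) ≡ from-αeγ (code6 t)
  E-place-code = toWitness {a? = all? λ t → xcode (E-place t) ≟ᵛ from-αeγ (code6 t)} _

  module BuildX (D E : Cycle G 6) {u w v : Fin n} {α β γ e : Fin d}
    (uD : Unique (α ∷ β ∷ γ ∷ [])) (e∉ : All (e ≢_) (α ∷ β ∷ γ ∷ []))
    (cD : CodedBy D (f w) (α ∷ β ∷ γ ∷ []) code6) (cE : CodedBy E (f w) (α ∷ e ∷ γ ∷ []) code6)
    (u-dir : f u ≡ flip γ (f w)) (v-dir : f v ≡ flip α (f w)) where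

    F4 : Vec (Fin d) 4
    F4 = e ∷ α ∷ β ∷ γ ∷ []

    open InFrame (f w) F4 (e∉ ∷ uD)

    cD4 : CodedBy D (f w) F4 (λ t → false ∷ code6 t)
    cD4 = recode (false ∷_) (λ s → refl) cD

    cE4 : CodedBy E (f w) F4 (from-αeγ ∘ code6)
    cE4 = recode from-αeγ (λ { (a ∷ b ∷ c ∷ []) → swap-first (f w) α e (γ ∷ []) a b (c ∷ []) }) cE

    v₁ v₂ v₄ v₅ c₁ c₂ : Fin n
    v₁ = proj₁ (CodedBy.carrier cE4 2F)
    v₂ = proj₁ (CodedBy.carrier cE4 3F)
    v₄ = proj₁ (CodedBy.carrier cD4 3F)
    v₅ = proj₁ (CodedBy.carrier cD4 4F)
    c₁ = proj₁ (CodedBy.carrier cD4 2F)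
    c₂ = proj₁ (CodedBy.carrier cE4 4F)

    v₁-code : v₁ ↦ xcode 0F
    v₁-code = proj₂ (CodedBy.carrier cE4 2F)
    v₂-code : v₂ ↦ xcode 1F
    v₂-code = proj₂ (CodedBy.carrier cE4 3F)
    v₄-code : v₄ ↦ xcode 3F
    v₄-code = proj₂ (CodedBy.carrier cD4 3F)
    c₁-code : c₁ ↦ xcode 8F
    c₁-code = proj₂ (CodedBy.carrier cD4 2F)

    u-neighbours : ∀ {m} → m ↦ (false ∷ true ∷ false ∷ true ∷ []) → ⊥
    u-neighbours {m} m-code = no-four-neighbours (w ∷ c₁ ∷ v₁ ∷ m ∷ [])
      ( (apart (xcode 6F) (xcode 8F) refl c₁-code (λ ()) ∷ apart (xcode 6F) (xcode 0F) refl v₁-code (λ ())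
          ∷ apart (xcode 6F) m-c refl m-code (λ ()) ∷ [])
      ∷ (apart (xcode 8F) (xcode 0F) c₁-code v₁-code (λ ()) ∷ apart (xcode 8F) m-c c₁-code m-code (λ ()) ∷ [])
      ∷ (apart (xcode 0F) m-c v₁-code m-code (λ ()) ∷ []) ∷ [] ∷ [])
      (near (xcode 6F) refl refl ∷ near (xcode 8F) c₁-code refl ∷ near (xcode 0F) v₁-code refl ∷ near m-c m-code refl ∷ [])
      where
      m-c : Vec Bool 4
      m-c = false ∷ true ∷ false ∷ true ∷ []
      apart : ∀ {x y} s t → x ↦ s → y ↦ t → s ≢ t → x ≢ y
      apart s t = code-distinct {s = s} {t = t}
      near : ∀ {x} s → x ↦ s → ham (xcode 7F) s ≡ 1 → Adj G u x
      near s x↦s = code-ham⇒adj {s = xcode 7F} {t = s} u-dir x↦s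

    -- The middle vertex of a geodesic from v₄ (0111) to v₂ (1101) has code
    -- 1111: the other candidates are at the wrong distance from v₂, or would
    -- be a fourth neighbour of u.
    middle-code : ∀ {m} → Adj G v₄ m → Adj G m v₂ → m ↦ xcode 2F
    middle-code {m} v₄~m m~v₂ = case neighbour {s = xcode 3F} v₄-code v₄~m of λ where
      (inj₁ (0F , e)) → e
      (inj₁ (1F , e)) → contradiction (adj⇒code-ham {s = false ∷ false ∷ true ∷ true ∷ []} {t = xcode 1F} e v₂-code m~v₂) λ ()
      (inj₁ (2F , e)) → ⊥-elim (u-neighbours e)
      (inj₁ (3F , e)) → contradiction (adj⇒code-ham {s = false ∷ true ∷ true ∷ false ∷ []} {t = xcode 1F} e v₂-code m~v₂) λ ()
      (inj₂ (z , z∉ , e)) → contradiction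
        (InFrame.adj⇒code-ham (f w) (z ∷ F4) (z∉ ∷ e∉ ∷ uD) {s = true ∷ xcode 3F} {t = false ∷ xcode 1F} e v₂-code m~v₂) λ ()

    middle : Walk G v₄ v₂ 2 → Σ (Fin n) λ m → Adj G v₄ m × Adj G m v₂
    middle (cons a (cons b nil)) = _ , a , b

    geodesic-middle : Σ (Fin n) λ m → Adj G v₄ m × Adj G m v₂
    geodesic-middle = middle (proj₁ (ham⇒dist {v₄} {v₂} (code-ham {s = xcode 3F} {t = xcode 1F} v₄-code v₂-code)))

    g : Fin 10 → Fin n
    g 0F = v₁
    g 1F = v₂
    g 2F = proj₁ geodesic-middle
    g 3F = v₄
    g 4F = v₅
    g 5F = v
    g 6F = w
    g 7F = u
    g 8F = c₁
    g 9F = c₂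

    g-code : ∀ a → g a ↦ xcode a
    g-code 0F = v₁-code
    g-code 1F = v₂-code
    g-code 2F = middle-code (proj₁ (proj₂ geodesic-middle)) (proj₂ (proj₂ geodesic-middle))
    g-code 3F = v₄-code
    g-code 4F = proj₂ (CodedBy.carrier cD4 4F)
    g-code 5F = v-dir
    g-code 6F = refl
    g-code 7F = u-dir
    g-code 8F = c₁-code
    g-code 9F = proj₂ (CodedBy.carrier cE4 4F)

    covers : ∀ (C : Cycle G 6) {c : Fin 6 → Vec Bool 4} (place : Fin 6 → Fin 10) →
      (∀ t → xcode (place t) ≡ c t) → CodedBy C (f w) F4 c → ∀ i → Σ (Fin 10) λ a → g a ≡ vtx C i
    covers C {c} place place-code cC i =
      let t , i-code = CodedBy.code-of cC i
      in place t , same-code {s = c t} (subst (g (place t) ↦_) (place-code t) (g-code (place t))) i-code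

    in-X : InX D E
    in-X = g , coded-isometry XGraph xcode edge-codeX xcode-injective descendX g g-code
             , contained (e∉ ∷ uD) g g-code D (covers D D-place D-place-code cD4)
             , contained (e∉ ∷ uD) g g-code E (covers E E-place E-place-code cE4)

  module CommonPath (D E : Cycle G 6) (isoD : IsometricCycle D) (isoE : IsometricCycle E) (D≠E : ¬ SameCycle D E)
    {u w v} (Duw : EdgeOf D u w) (Dwv : EdgeOf D w v) (Euw : EdgeOf E u w) (Ewv : EdgeOf E w v) (u≢v : u ≢ v) where

    HD : HexFrame D w u
    HD = hexframe-at D isoD Duw
    HE : HexFrame E w u
    HE = hexframe-at E isoE Euw
    module HD = HexFrame HD
    module HE = HexFrame HE

    -- Once the directions of u and v agree, the middle direction decides.
    aligned : ∀ {α β γ α' β' γ'} → α' ≡ α → γ' ≡ γ → Unique (α ∷ β ∷ γ ∷ []) → Unique (α' ∷ β' ∷ γ' ∷ []) →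
      CodedBy D (f w) (α ∷ β ∷ γ ∷ []) code6 → CodedBy E (f w) (α' ∷ β' ∷ γ' ∷ []) code6 →
      f u ≡ flip γ (f w) → f v ≡ flip α (f w) → InX D E
    aligned {α} {β} {γ} {β' = β'} refl refl uD uE cD cE u-dir v-dir = case membership β' (α ∷ β ∷ γ ∷ []) of λ where
      (inj₁ (here refl))                → ⊥-elim (first-distinct uE refl)
      (inj₁ (there (here refl)))        → ⊥-elim (D≠E (same-coding⇒same-cycle D E isoD isoE cD cE))
      (inj₁ (there (there (here refl)))) → ⊥-elim (second-distinct uE refl)
      (inj₂ β'∉)                        → BuildX.in-X D E uD β'∉ cD cE u-dir v-dir

    in-X : InX D E
    in-X = aligned same-α same-γ HD.unique HE.unique HD.coding HE.coding HD.u-dir v-D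
      where
      v-D : f v ≡ flip HD.α (f w)
      v-D = other-neighbour HD (edge-right D Dwv) (edge-adj simple D Dwv) u≢v
      v-E : f v ≡ flip HE.α (f w)
      v-E = other-neighbour HE (edge-right E Ewv) (edge-adj simple E Ewv) u≢v
      same-α : HE.α ≡ HD.α
      same-α = flip-injectiveˡ HE.α HD.α (f w) (trans (sym v-E) v-D)
      same-γ : HE.γ ≡ HD.γ
      same-γ = flip-injectiveˡ HE.γ HD.γ (f w) (trans (sym HE.u-dir) HD.u-dir)

  FewCommonCodes : ∀ {m} → (Fin 6 → Vec Bool m) → (Fin 6 → Vec Bool m) → Vec Bool m → Set
  FewCommonCodes cD cE K = ∀ tD tE → cD tD ≡ cE tE → cD tD ≡ cD 0F ⊎ cD tD ≡ cD 1F ⊎ cD tD ≡ K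

  few-common-codes? : ∀ {m} (cD cE : Fin 6 → Vec Bool m) K → Dec (FewCommonCodes cD cE K)
  few-common-codes? cD cE K = all? λ tD → all? λ tE →
    (cD tD ≟ᵛ cE tE) →-dec ((cD tD ≟ᵛ cD 0F) ⊎-dec (cD tD ≟ᵛ cD 1F) ⊎-dec (cD tD ≟ᵛ K))

  -- Codes in a frame of E centred at x, rewritten in a frame extending the
  -- frame (α, β, γ) of D; e and e' denote directions outside D's frame.
  from-βeγ from-eαγ from-eβγ : Vec Bool 3 → Vec Bool 4   -- into (e, α, β, γ)
  from-βeγ (a ∷ b ∷ c ∷ []) = b ∷ false ∷ a ∷ c ∷ []
  from-eαγ (a ∷ b ∷ c ∷ []) = a ∷ b ∷ false ∷ c ∷ []
  from-eβγ (a ∷ b ∷ c ∷ []) = a ∷ false ∷ b ∷ c ∷ []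

  from-ee'γ : Vec Bool 3 → Vec Bool 5                              -- into (e, e', α, β, γ)
  from-ee'γ (a ∷ b ∷ c ∷ []) = a ∷ b ∷ false ∷ false ∷ c ∷ []

  from-βαγ : Vec Bool 3 → Vec Bool 3                               -- into (α, β, γ)
  from-βαγ (a ∷ b ∷ c ∷ []) = b ∷ a ∷ c ∷ []

  D-codes₄ : Fin 6 → Vec Bool 4
  D-codes₄ t = false ∷ code6 t

  few-αeγ : FewCommonCodes D-codes₄ (from-αeγ ∘ code6) (false ∷ true ∷ false ∷ false ∷ [])
  few-αeγ = toWitness {a? = few-common-codes? D-codes₄ (from-αeγ ∘ code6) (false ∷ true ∷ false ∷ false ∷ [])} _

  few-βeγ : FewCommonCodes D-codes₄ (from-βeγ ∘ code6) (false ∷ false ∷ false ∷ false ∷ [])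
  few-βeγ = toWitness {a? = few-common-codes? D-codes₄ (from-βeγ ∘ code6) (false ∷ false ∷ false ∷ false ∷ [])} _

  few-eαγ : FewCommonCodes D-codes₄ (from-eαγ ∘ code6) (false ∷ false ∷ false ∷ false ∷ [])
  few-eαγ = toWitness {a? = few-common-codes? D-codes₄ (from-eαγ ∘ code6) (false ∷ false ∷ false ∷ false ∷ [])} _

  few-eβγ : FewCommonCodes D-codes₄ (from-eβγ ∘ code6) (false ∷ false ∷ true ∷ true ∷ [])
  few-eβγ = toWitness {a? = few-common-codes? D-codes₄ (from-eβγ ∘ code6) (false ∷ false ∷ true ∷ true ∷ [])} _

  few-ee'γ : FewCommonCodes (λ t → false ∷ false ∷ code6 t) (from-ee'γ ∘ code6) (false ∷ false ∷ false ∷ false ∷ false ∷ [])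
  few-ee'γ = toWitness {a? = few-common-codes? (λ t → false ∷ false ∷ code6 t) (from-ee'γ ∘ code6) (false ∷ false ∷ false ∷ false ∷ false ∷ [])} _

  module DisjointEdges (D E : Cycle G 6) (isoD : IsometricCycle D) (isoE : IsometricCycle E) (D≠E : ¬ SameCycle D E)
    {x y x' y'} (Dxy : EdgeOf D x y) (Exy : EdgeOf E x y) (Dx'y' : EdgeOf D x' y') (Ex'y' : EdgeOf E x' y')
    (x≢x' : x ≢ x') (x≢y' : x ≢ y') (y≢x' : y ≢ x') (y≢y' : y ≢ y') where

    -- With few common codes, both x' and y' would carry the code K.
    no-second-edge : ∀ {m} {F : Vec (Fin d) m} (uF : Unique F) {cD cE K} → CodedBy D (f x) F cD → CodedBy E (f x) F cE →
      f x ≡ pos (f x) F (cD 0F) → f y ≡ pos (f x) F (cD 1F) → FewCommonCodes cD cE K → ⊥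
    no-second-edge {F = F} uF {cD} {cE} {K} codedD codedE x-code y-code few =
      proj₂ simple x' (subst (Adj G x') (sym (same-code {s = K} (K-code x≢x' y≢x' (edge-left D Dx'y') (edge-left E Ex'y'))
                                                               (K-code x≢y' y≢y' (edge-right D Dx'y') (edge-right E Ex'y'))))
                                 (edge-adj simple D Dx'y'))
      where
      open InFrame (f x) F uF
      K-code : ∀ {z} → x ≢ z → y ≢ z → OnCycle z D → OnCycle z E → z ↦ K
      K-code x≢z y≢z (i , refl) (j , eⱼ) =
        let tD , eD = CodedBy.code-of codedD i
            tE , eE = CodedBy.code-of codedE j
        in case few tD tE (code-unique {s = cD tD} {t = cE tE} eD (trans (cong f (sym eⱼ)) eE)) of λ where
          (inj₁ c)        → ⊥-elim (x≢z (same-code {s = cD tD} (trans x-code (cong (pos (f x) F) (sym c))) eD))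
          (inj₂ (inj₁ c)) → ⊥-elim (y≢z (same-code {s = cD tD} (trans y-code (cong (pos (f x) F) (sym c))) eD))
          (inj₂ (inj₂ c)) → subst (vtx D i ↦_) c eD

    cube-codes : ∀ {α β γ} → CodedBy D (f x) (α ∷ β ∷ γ ∷ []) code6 → CodedBy E (f x) (α ∷ β ∷ γ ∷ []) (from-βαγ ∘ code6) →
      ∀ s → Σ (Fin n) λ z → f z ≡ pos (f x) (α ∷ β ∷ γ ∷ []) s
    cube-codes cD cE (false ∷ false ∷ false ∷ []) = CodedBy.carrier cD 0F
    cube-codes cD cE (false ∷ false ∷ true  ∷ []) = CodedBy.carrier cD 1F
    cube-codes cD cE (false ∷ true  ∷ true  ∷ []) = CodedBy.carrier cD 2F
    cube-codes cD cE (true  ∷ true  ∷ true  ∷ []) = CodedBy.carrier cD 3F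
    cube-codes cD cE (true  ∷ true  ∷ false ∷ []) = CodedBy.carrier cD 4F
    cube-codes cD cE (true  ∷ false ∷ false ∷ []) = CodedBy.carrier cD 5F
    cube-codes cD cE (true  ∷ false ∷ true  ∷ []) = CodedBy.carrier cE 2F
    cube-codes cD cE (false ∷ true  ∷ false ∷ []) = CodedBy.carrier cE 5F

    aligned : ∀ {α β γ α' β' γ'} → γ' ≡ γ → Unique (α ∷ β ∷ γ ∷ []) → Unique (α' ∷ β' ∷ γ' ∷ []) →
      CodedBy D (f x) (α ∷ β ∷ γ ∷ []) code6 → CodedBy E (f x) (α' ∷ β' ∷ γ' ∷ []) code6 →
      f y ≡ flip γ (f x) → Isomorphic G (Hypercube 3)
    aligned {α} {β} {γ} {α'} {β'} refl uD uE cD cE y-dir =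
      case membership α' (α ∷ β ∷ γ ∷ []) , membership β' (α ∷ β ∷ γ ∷ []) of λ where
        (inj₁ (there (there (there ()))) , _)
        (_ , inj₁ (there (there (there ()))))
        (inj₁ (there (there (here refl))) , _) → ⊥-elim (first-third-distinct uE refl)
        (_ , inj₁ (there (there (here refl)))) → ⊥-elim (second-distinct uE refl)
        (inj₁ (here refl) , inj₁ (here refl)) → ⊥-elim (first-distinct uE refl)
        (inj₁ (there (here refl)) , inj₁ (there (here refl))) → ⊥-elim (first-distinct uE refl)
        (inj₁ (here refl) , inj₁ (there (here refl))) → ⊥-elim (D≠E (same-coding⇒same-cycle D E isoD isoE cD cE))
        (inj₁ (there (here refl)) , inj₁ (here refl)) →
          CubeRecognition.is-cube G simple f iso cubic (f x) (α ∷ β ∷ γ ∷ []) uD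
            (cube-codes cD (recode from-βαγ (λ { (a ∷ b ∷ c ∷ []) → swap-first (f x) β α (γ ∷ []) a b (c ∷ []) }) cE))
        (inj₁ (here refl) , inj₂ β'∉) → ⊥-elim (no-second-edge (β'∉ ∷ uD) (recode (false ∷_) (λ _ → refl) cD)
          (recode from-αeγ (λ { (a ∷ b ∷ c ∷ []) → swap-first (f x) α β' (γ ∷ []) a b (c ∷ []) }) cE) refl y-dir few-αeγ)
        (inj₁ (there (here refl)) , inj₂ β'∉) → ⊥-elim (no-second-edge (β'∉ ∷ uD) (recode (false ∷_) (λ _ → refl) cD)
          (recode from-βeγ (λ { (a ∷ b ∷ c ∷ []) → swap-first (f x) β β' (γ ∷ []) a b (c ∷ []) }) cE) refl y-dir few-βeγ)
        (inj₂ α'∉ , inj₁ (here refl)) → ⊥-elim (no-second-edge (α'∉ ∷ uD) (recode (false ∷_) (λ _ → refl) cD)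
          (recode from-eαγ (λ { (a ∷ b ∷ c ∷ []) → refl }) cE) refl y-dir few-eαγ)
        (inj₂ α'∉ , inj₁ (there (here refl))) → ⊥-elim (no-second-edge (α'∉ ∷ uD) (recode (false ∷_) (λ _ → refl) cD)
          (recode from-eβγ (λ { (a ∷ b ∷ c ∷ []) → refl }) cE) refl y-dir few-eβγ)
        (inj₂ α'∉ , inj₂ β'∉) → ⊥-elim (no-second-edge ((first-distinct uE ∷ α'∉) ∷ β'∉ ∷ uD)
          (recode (λ s → false ∷ false ∷ s) (λ _ → refl) cD)
          (recode from-ee'γ (λ { (a ∷ b ∷ c ∷ []) → refl }) cE) refl y-dir few-ee'γ)

    is-cube : Isomorphic G (Hypercube 3)
    is-cube = aligned same-γ HD.unique HE.unique HD.coding HE.coding HD.u-dir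
      where
      HD : HexFrame D x y
      HD = hexframe-at D isoD (edge-sym D Dxy)
      HE : HexFrame E x y
      HE = hexframe-at E isoE (edge-sym E Exy)
      module HD = HexFrame HD
      module HE = HexFrame HE
      same-γ : HE.γ ≡ HD.γ
      same-γ = flip-injectiveˡ HE.γ HD.γ (f x) (trans (sym HE.u-dir) HD.u-dir)

  shared-edges⇒cube-or-X : ∀ (D E : Cycle G 6) → IsometricCycle D → IsometricCycle E → ¬ SameCycle D E → ShareTwoEdges D E →
    Isomorphic G (Hypercube 3) ⊎ InX D E
  shared-edges⇒cube-or-X D E isoD isoE D≠E shared with shared-edges D E shared
  ... | common-path u w v Duw Dwv Euw Ewv u≢v = inj₂ (CommonPath.in-X D E isoD isoE D≠E Duw Dwv Euw Ewv u≢v)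
  ... | disjoint x y x' y' Dxy Exy Dx'y' Ex'y' x≢x' x≢y' y≢x' y≢y' =
    inj₁ (DisjointEdges.is-cube D E isoD isoE D≠E Dxy Exy Dx'y' Ex'y' x≢x' x≢y' y≢x' y≢y')

lemma3p2 : ∀ {n : ℕ} (G : Graph (Fin n)) → Simple G → Cubic G → PartialCube G →
    (∀ (C : Cycle G 4) (D : Cycle G 6) → IsometricCycle D → ShareTwoEdges C D →
      Σ (Fin n) λ v → Σ (Cycle G 4) λ C₁ → Σ (Cycle G 4) λ C₂ → Σ (Cycle G 4) λ C₃ →
        ¬ SameCycle C₁ C₂ × ¬ SameCycle C₁ C₃ × ¬ SameCycle C₂ C₃ ×
        OnCycle v C₁ × OnCycle v C₂ × OnCycle v C₃)
    ×
    (∀ (D E : Cycle G 6) → IsometricCycle D → IsometricCycle E → ¬ SameCycle D E →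
      ShareTwoEdges D E →
      Isomorphic G (Hypercube 3)
      ⊎ Σ (Fin 10 → Fin n) λ f → IsometricEmbedding XGraph G f × ContainedIn D f × ContainedIn E f)
lemma3p2 G simple cubic (d , f , iso) =
  SquareAndHexagon.shared-edges⇒three-squares G simple f iso ,
  TwoHexagons.shared-edges⇒cube-or-X G simple f iso cubic
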